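{- Let $s,t\ge 3$ be integers and let $X(s,t)$ be the graph defined in the context. Then $X(s,t)$ is 3-connected and not bipartite, and if $s$ and $t$ are both odd, then the chromatic polynomial $P(X(s,t),x)$ has a real root in the open interval $(1,2)$.
   Context: For a finite graph $G$, the chromatic polynomial $P(G,x)$ is the unique polynomial such that for every natural number $k$, $P(G,k)$ is the number of proper colourings of $G$ with at most $k$ colours; a chromatic root of $G$ is a zero of $P(G,x)$. For integers $s,t\ge 3$, the graph $X(s,t)$ has vertex set $\{v_0,v_1,v_2,v_3,v_4\}\cup S\cup T$, where $S$ is a set of $s$ vertices and $T$ is a set of $t$ vertices (all these sets pairwise disjoint), and edge set consisting of: the edge $v_1v_2$; the edge $v_3v_4$; all edges $v_1u$, $v_3u$ and $v_0u$ for $u\in S$; and all edges $v_2w$, $v_4w$ and $v_0w$ for $w\in T$. There are no other edges (in particular $S$ and $T$ are independent sets). -}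

module Defs where

open import Data.Nat as ℕ using (ℕ; zero; suc)
open import Data.Bool using (Bool; true; false; _∧_; _∨_; not)
open import Data.Fin as Fin using (Fin; splitAt)
open import Data.Fin.Subset using (Subset; _∈_; _∉_) renaming (∣_∣ to size)
open import Data.Sum using (_⊎_; inj₁; inj₂)
open import Data.List using (List; []; _∷_; map; concatMap; filterᵇ; length; allFin; foldr)
open import Data.Bool.ListAction using (and)
open import Data.Vec using (Vec; []; _∷_; lookup)
open import Data.Product using (Σ; _×_; _,_; ∃)
open import Data.Integer using (+_)
open import Data.Rational using (ℚ; _+_; _*_; _-_; _≤_; _<_; ∣_∣; 0ℚ; 1ℚ; _/_)
open import Relation.Binary.PropositionalEquality using (_≡_; _≢_)
open import Relation.Nullary using (¬_)
open import Relation.Nullary.Decidable using (⌊_⌋)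

record Graph : Set where
  field
    n   : ℕ
    adj : Fin n → Fin n → Bool
open Graph public

-- The graph X(s,t).  Vertex set Fin (5 + (s + t)):
-- 0..4 are v0..v4, the next s vertices form S, the last t form T.

data Kind : Set where
  V0 V1 V2 V3 V4 InS InT : Kind

kind : (s t : ℕ) → Fin (5 ℕ.+ (s ℕ.+ t)) → Kind
kind s t i with splitAt 5 i
... | inj₁ Fin.zero = V0
... | inj₁ (Fin.suc Fin.zero) = V1
... | inj₁ (Fin.suc (Fin.suc Fin.zero)) = V2
... | inj₁ (Fin.suc (Fin.suc (Fin.suc Fin.zero))) = V3
... | inj₁ (Fin.suc (Fin.suc (Fin.suc (Fin.suc Fin.zero)))) = V4
... | inj₂ j with splitAt s j
...   | inj₁ _ = InS
...   | inj₂ _ = InT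

edgeKind : Kind → Kind → Bool
edgeKind V1 V2  = true
edgeKind V3 V4  = true
edgeKind V1 InS = true
edgeKind V3 InS = true
edgeKind V0 InS = true
edgeKind V2 InT = true
edgeKind V4 InT = true
edgeKind V0 InT = true
edgeKind _  _   = false

X : ℕ → ℕ → Graph
X s t = record
  { n   = 5 ℕ.+ (s ℕ.+ t)
  ; adj = λ i j → edgeKind (kind s t i) (kind s t j) ∨ edgeKind (kind s t j) (kind s t i)
  }

Bipartite : Graph → Set
Bipartite G = Σ (Fin (n G) → Bool) λ f →
  ∀ i j → adj G i j ≡ true → f i ≢ f j

data Reach (G : Graph) (W : Subset (n G)) : Fin (n G) → Fin (n G) → Set where
  here : ∀ {u} → u ∉ W → Reach G W u u
  step : ∀ {u w v} → u ∉ W → adj G u w ≡ true → Reach G W w v → Reach G W u v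

ConnectedWithout : (G : Graph) → Subset (n G) → Set
ConnectedWithout G W = ∀ u v → u ∉ W → v ∉ W → Reach G W u v

KConnected : ℕ → Graph → Set
KConnected k G = k ℕ.< n G × (∀ (W : Subset (n G)) → size W ℕ.< k → ConnectedWithout G W)

allVecs : (m k : ℕ) → List (Vec (Fin k) m)
allVecs zero    k = [] ∷ []
allVecs (suc m) k = concatMap (λ c → map (c ∷_) (allVecs m k)) (allFin k)

properB : (G : Graph) {k : ℕ} → Vec (Fin k) (n G) → Bool
properB G c = and (concatMap (λ i → map (λ j →
  not (adj G i j ∧ ⌊ lookup c i Fin.≟ lookup c j ⌋)) (allFin (n G))) (allFin (n G)))

numColourings : Graph → ℕ → ℕ
numColourings G k = length (filterᵇ (properB G) (allVecs (n G) k))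

-- Polynomials with rational coefficients (coefficient list, constant
-- term first) and evaluation.

Poly : Set
Poly = List ℚ

evalQ : Poly → ℚ → ℚ
evalQ p x = foldr (λ a acc → a + x * acc) 0ℚ p

ℕtoℚ : ℕ → ℚ
ℕtoℚ m = + m / 1

-- p is the chromatic polynomial of G: p(k) = number of proper k-colourings
-- for every natural number k (this determines p as a polynomial function).
IsChromaticPolynomial : Graph → Poly → Set
IsChromaticPolynomial G p = ∀ k → evalQ p (ℕtoℚ k) ≡ ℕtoℚ (numColourings G k)

-- Real numbers as (Bishop-)regular Cauchy sequences of rationals.

1/suc : ℕ → ℚ
1/suc m = + 1 / suc m

IsRegular : (ℕ → ℚ) → Set
IsRegular q = ∀ i j → ∣ q i - q j ∣ ≤ 1/suc i + 1/suc j

StrictlyBetween : ℚ → ℚ → (ℕ → ℚ) → Set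
StrictlyBetween a b q = Σ ℕ λ N → Σ ℕ λ d →
  ∀ i → N ℕ.≤ i → (a + 1/suc d ≤ q i) × (q i + 1/suc d ≤ b)

-- p vanishes at the real number represented by q
-- (p(lim q) = lim p(q i), polynomials being continuous).
VanishesAt : Poly → (ℕ → ℚ) → Set
VanishesAt p q = ∀ e → Σ ℕ λ N → ∀ i → N ℕ.≤ i → ∣ evalQ p (q i) ∣ ≤ 1/suc e

HasRealRootIn : ℚ → ℚ → Poly → Set
HasRealRootIn a b p = Σ (ℕ → ℚ) λ q → IsRegular q × StrictlyBetween a b q × VanishesAt p q

Odd : ℕ → Set
Odd m = Σ ℕ λ k → m ≡ suc (2 ℕ.* k)

module Submission where

-- Deleting two vertices from X(s,t) cannot block all three internally disjoint T–S routes via v₀,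
-- v₂v₁ and v₄v₃, and v₁ S v₀ T v₂ is an odd cycle. For the root, colour v₀,…,v₄ first: every
-- S-vertex then independently avoids the colours of v₀, v₁, v₃ and every T-vertex those of v₀, v₂,
-- v₄, which gives P(X(s,t), x) = x(x-1)(x-2)H(x) in closed form. For odd s and t all exponents in
-- H(1) and H(2) are even, so H(1) ≥ 1 and H(2) = -1, and bisection, controlled by a Lipschitz bound
-- for H on [0,2], produces the root as a regular Cauchy sequence.

open import Level using (0ℓ)
open import Function using (_∘_)
open import Data.Empty using (⊥; ⊥-elim)
open import Data.Bool using (Bool; true; false; _∧_; _∨_; not; if_then_else_)
open import Data.Bool.Properties using (∨-comm; ∧-comm; ∧-zeroʳ; ¬-not; not-¬; not-involutive)
open import Data.Bool.ListAction using (and)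
open import Data.Nat as ℕ using (ℕ; zero; suc; s≤s; z≤n)
import Data.Nat.Properties as ℕP
import Data.Nat.Coprimality as Coprimality
open import Data.Integer as ℤ using (ℤ)
import Data.Integer.Properties as ℤP
open import Data.Fin as Fin using (Fin; zero; suc; punchIn; punchOut; _↑ˡ_; _↑ʳ_; splitAt)
open import Data.Fin.Properties
  using (punchInᵢ≢i; punchIn-injective; punchIn-punchOut; splitAt-↑ˡ; splitAt-↑ʳ; splitAt⁻¹-↑ˡ; splitAt⁻¹-↑ʳ; suc-injective; ↑ʳ-injective)
open import Data.Fin.Subset using (Subset; _∈_; _∉_) renaming (∣_∣ to size; _-_ to _∖_)
open import Data.Fin.Subset.Properties using (_∈?_; x∈p⇒∣p-x∣<∣p∣; x∈p∧x≢y⇒x∈p-y)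
open import Data.Product using (Σ; _×_; _,_; proj₁; proj₂)
open import Data.Sum using (_⊎_; inj₁; inj₂)
open import Data.List using (List; []; _∷_; _++_; length; map; concatMap; filterᵇ; tabulate)
open import Data.List.Relation.Unary.All using (All; []; _∷_)
import Data.List.Relation.Unary.All.Properties as All
open import Data.Vec using (Vec; []; _∷_; lookup)
open import Data.Rational hiding (floor; ceiling)
open import Data.Rational.Properties
import Data.Rational.Unnormalised as ℚᵘ
import Data.Rational.Unnormalised.Properties as ℚᵘP
open import Data.Rational.Solver using (module +-*-Solver)
open import Algebra.Bundles using (CommutativeRing; RawSemiring)
open import Algebra.Properties.Semiring.Sum (CommutativeRing.semiring +-*-commutativeRing)
  using (sum; sum-syntax; sum-cong-≗; sum-remove; ∑-comm; *-distribˡ-sum; *-distribʳ-sum)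
open import Relation.Binary.PropositionalEquality
open import Relation.Nullary using (¬_; yes; no)
open import Relation.Nullary.Decidable using (⌊_⌋)

open import Defs

open +-*-Solver hiding (⟦_⟧)

fraction-toℚᵘ : ∀ a b → toℚᵘ (ℤ.+ a / suc b) ℚᵘ.≃ ℚᵘ.mkℚᵘ (ℤ.+ a) b
fraction-toℚᵘ a b = toℚᵘ-fromℚᵘ (ℚᵘ.mkℚᵘ (ℤ.+ a) b)

ℕtoℚ-+ : ∀ a b → ℕtoℚ (a ℕ.+ b) ≡ ℕtoℚ a + ℕtoℚ b
ℕtoℚ-+ a b = toℚᵘ-injective (begin
  toℚᵘ (ℕtoℚ (a ℕ.+ b))                 ≈⟨ fraction-toℚᵘ (a ℕ.+ b) 0 ⟩
  ℚᵘ.mkℚᵘ (ℤ.+ (a ℕ.+ b)) 0             ≈⟨ ℚᵘ.*≡* (cong (ℤ._* ℤ.+ 1) (cong₂ ℤ._+_ (sym (ℤP.*-identityʳ (ℤ.+ a))) (sym (ℤP.*-identityʳ (ℤ.+ b))))) ⟩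
  ℚᵘ.mkℚᵘ (ℤ.+ a) 0 ℚᵘ.+ ℚᵘ.mkℚᵘ (ℤ.+ b) 0 ≈⟨ ℚᵘP.+-cong (fraction-toℚᵘ a 0) (fraction-toℚᵘ b 0) ⟨
  toℚᵘ (ℕtoℚ a) ℚᵘ.+ toℚᵘ (ℕtoℚ b)       ≈⟨ toℚᵘ-homo-+ (ℕtoℚ a) (ℕtoℚ b) ⟨
  toℚᵘ (ℕtoℚ a + ℕtoℚ b)                ∎)
  where open ℚᵘP.≃-Reasoning

ℕtoℚ-suc : ∀ a → ℕtoℚ (suc a) ≡ 1ℚ + ℕtoℚ a
ℕtoℚ-suc = ℕtoℚ-+ 1

fraction-≤ : ∀ a b c d → a ℕ.* suc d ℕ.≤ c ℕ.* suc b → ℤ.+ a / suc b ≤ ℤ.+ c / suc d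
fraction-≤ a b c d h = toℚᵘ-cancel-≤ (ℚᵘP.≤-respˡ-≃ (ℚᵘP.≃-sym (fraction-toℚᵘ a b))
  (ℚᵘP.≤-respʳ-≃ (ℚᵘP.≃-sym (fraction-toℚᵘ c d))
  (ℚᵘ.*≤* (subst₂ ℤ._≤_ (ℤP.pos-* a (suc d)) (ℤP.pos-* c (suc b)) (ℤ.+≤+ h)))))

fraction-* : ∀ a b c d → (ℤ.+ a / suc b) * (ℤ.+ c / suc d) ≡ ℤ.+ (a ℕ.* c) / (suc b ℕ.* suc d)
fraction-* a b c d = toℚᵘ-injective (begin
  toℚᵘ ((ℤ.+ a / suc b) * (ℤ.+ c / suc d))  ≈⟨ toℚᵘ-homo-* (ℤ.+ a / suc b) (ℤ.+ c / suc d) ⟩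
  toℚᵘ (ℤ.+ a / suc b) ℚᵘ.* toℚᵘ (ℤ.+ c / suc d) ≈⟨ ℚᵘP.*-cong (fraction-toℚᵘ a b) (fraction-toℚᵘ c d) ⟩
  ℚᵘ.mkℚᵘ (ℤ.+ a) b ℚᵘ.* ℚᵘ.mkℚᵘ (ℤ.+ c) d    ≈⟨ ℚᵘ.*≡* (cong (ℤ._* ℤ.+ suc (d ℕ.+ b ℕ.* suc d)) (sym (ℤP.pos-* a c))) ⟩
  ℚᵘ.mkℚᵘ (ℤ.+ (a ℕ.* c)) (d ℕ.+ b ℕ.* suc d) ≈⟨ fraction-toℚᵘ (a ℕ.* c) (d ℕ.+ b ℕ.* suc d) ⟨
  toℚᵘ (ℤ.+ (a ℕ.* c) / (suc b ℕ.* suc d))   ∎)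
  where open ℚᵘP.≃-Reasoning

0≤fraction : ∀ a b → 0ℚ ≤ ℤ.+ a / suc b
0≤fraction a b = fraction-≤ 0 0 a b z≤n

archimedean : ∀ r → Σ ℕ λ n → r ≤ ℕtoℚ n
archimedean (mkℚ (ℤ.+ n) d _) = n , toℚᵘ-cancel-≤ (ℚᵘP.≤-respʳ-≃ (ℚᵘP.≃-sym (fraction-toℚᵘ n 0))
   (ℚᵘ.*≤* (subst₂ ℤ._≤_ (ℤP.pos-* n 1) (ℤP.pos-* n (suc d)) (ℤ.+≤+ (ℕP.*-monoʳ-≤ n (s≤s z≤n))))))
archimedean (mkℚ ℤ.-[1+ n ] d _) = 0 , *≤* (subst₂ ℤ._≤_ (sym (ℤP.*-identityʳ ℤ.-[1+ n ])) (sym (ℤP.*-zeroˡ (ℤ.+ suc d))) ℤ.-≤+)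

*-monoˡ-≤-0≤ : ∀ {r p q} → 0ℚ ≤ r → p ≤ q → r * p ≤ r * q
*-monoˡ-≤-0≤ {r} 0≤r = *-monoˡ-≤-nonNeg r {{nonNegative 0≤r}}

*-monoʳ-≤-0≤ : ∀ {r p q} → 0ℚ ≤ r → p ≤ q → p * r ≤ q * r
*-monoʳ-≤-0≤ {r} 0≤r = *-monoʳ-≤-nonNeg r {{nonNegative 0≤r}}

*-mono-≤-0≤ : ∀ {a b c d} → 0ℚ ≤ a → 0ℚ ≤ c → a ≤ b → c ≤ d → a * c ≤ b * d
*-mono-≤-0≤ 0≤a 0≤c a≤b c≤d = ≤-trans (*-monoʳ-≤-0≤ 0≤c a≤b) (*-monoˡ-≤-0≤ (≤-trans 0≤a a≤b) c≤d)

0≤* : ∀ {a b} → 0ℚ ≤ a → 0ℚ ≤ b → 0ℚ ≤ a * b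
0≤* {a} 0≤a 0≤b = subst (_≤ a * _) (*-zeroʳ a) (*-monoˡ-≤-0≤ 0≤a 0≤b)

p≤q⇒0≤q-p : ∀ {p q} → p ≤ q → 0ℚ ≤ q - p
p≤q⇒0≤q-p {p} {q} p≤q = subst (_≤ q - p) (+-inverseʳ p) (+-monoˡ-≤ (- p) p≤q)

≤-by-difference : ∀ {p q} w → 0ℚ ≤ w → q - p ≡ w → p ≤ q
≤-by-difference {p} {q} w 0≤w q-p≡w = subst₂ _≤_ (+-identityˡ p) (solve 2 (λ p q → (q :- p) :+ p := q) refl p q)
  (+-monoˡ-≤ p (subst (0ℚ ≤_) (sym q-p≡w) 0≤w))

p≤∣p∣ : ∀ p → p ≤ ∣ p ∣
p≤∣p∣ p with ∣p∣≡p∨∣p∣≡-p p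
... | inj₁ ∣p∣≡p = ≤-reflexive (sym ∣p∣≡p)
... | inj₂ ∣p∣≡-p = ≤-by-difference (∣ p ∣ + ∣ p ∣) (+-mono-≤ (0≤∣p∣ p) (0≤∣p∣ p))
  (cong (λ z → ∣ p ∣ + z) (sym ∣p∣≡-p))

∣p-q∣≡∣q-p∣ : ∀ p q → ∣ p - q ∣ ≡ ∣ q - p ∣
∣p-q∣≡∣q-p∣ p q = trans (cong ∣_∣ (solve 2 (λ p q → p :- q := :- (q :- p)) refl p q)) (∣-p∣≡∣p∣ (q - p))

coefficientBound : ℚ → Poly → ℚ
coefficientBound r [] = 0ℚ
coefficientBound r (a ∷ q) = ∣ a ∣ + r * coefficientBound r q

lipschitzConstant : ℚ → Poly → ℚ
lipschitzConstant r [] = 0ℚ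
lipschitzConstant r (a ∷ q) = r * lipschitzConstant r q + coefficientBound r q

module _ {r : ℚ} (0≤r : 0ℚ ≤ r) where

  0≤coefficientBound : ∀ q → 0ℚ ≤ coefficientBound r q
  0≤coefficientBound [] = ≤-refl
  0≤coefficientBound (a ∷ q) = +-mono-≤ (0≤∣p∣ a) (0≤* 0≤r (0≤coefficientBound q))

  0≤lipschitzConstant : ∀ q → 0ℚ ≤ lipschitzConstant r q
  0≤lipschitzConstant [] = ≤-refl
  0≤lipschitzConstant (a ∷ q) = +-mono-≤ (0≤* 0≤r (0≤lipschitzConstant q)) (0≤coefficientBound q)

  ∣evalQ∣≤coefficientBound : ∀ q {x} → ∣ x ∣ ≤ r → ∣ evalQ q x ∣ ≤ coefficientBound r q
  ∣evalQ∣≤coefficientBound [] _ = ≤-refl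
  ∣evalQ∣≤coefficientBound (a ∷ q) {x} ∣x∣≤r = begin
    ∣ a + x * evalQ q x ∣           ≤⟨ ∣p+q∣≤∣p∣+∣q∣ a (x * evalQ q x) ⟩
    ∣ a ∣ + ∣ x * evalQ q x ∣       ≡⟨ cong (∣ a ∣ +_) (∣p*q∣≡∣p∣*∣q∣ x (evalQ q x)) ⟩
    ∣ a ∣ + ∣ x ∣ * ∣ evalQ q x ∣   ≤⟨ +-monoʳ-≤ ∣ a ∣ (*-mono-≤-0≤ (0≤∣p∣ x) (0≤∣p∣ _) ∣x∣≤r (∣evalQ∣≤coefficientBound q ∣x∣≤r)) ⟩
    ∣ a ∣ + r * coefficientBound r q ∎
    where open ≤-Reasoning

  evalQ-lipschitz : ∀ q {x y} → ∣ x ∣ ≤ r → ∣ y ∣ ≤ r → ∣ evalQ q x - evalQ q y ∣ ≤ lipschitzConstant r q * ∣ x - y ∣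
  evalQ-lipschitz [] {x} {y} _ _ = ≤-reflexive (sym (*-zeroˡ ∣ x - y ∣))
  evalQ-lipschitz (a ∷ q) {x} {y} ∣x∣≤r ∣y∣≤r = begin
    ∣ (a + x * qx) - (a + y * qy) ∣       ≡⟨ cong ∣_∣ (solve 5 (λ a x y u v → (a :+ x :* u) :- (a :+ y :* v) := x :* (u :- v) :+ (x :- y) :* v) refl a x y qx qy) ⟩
    ∣ x * (qx - qy) + (x - y) * qy ∣      ≤⟨ ∣p+q∣≤∣p∣+∣q∣ (x * (qx - qy)) ((x - y) * qy) ⟩
    ∣ x * (qx - qy) ∣ + ∣ (x - y) * qy ∣  ≡⟨ cong₂ _+_ (∣p*q∣≡∣p∣*∣q∣ x (qx - qy)) (∣p*q∣≡∣p∣*∣q∣ (x - y) qy) ⟩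
    ∣ x ∣ * ∣ qx - qy ∣ + ∣ x - y ∣ * ∣ qy ∣
      ≤⟨ +-mono-≤ (*-mono-≤-0≤ (0≤∣p∣ x) (0≤∣p∣ _) ∣x∣≤r (evalQ-lipschitz q ∣x∣≤r ∣y∣≤r))
                  (*-monoˡ-≤-0≤ (0≤∣p∣ (x - y)) (∣evalQ∣≤coefficientBound q ∣y∣≤r)) ⟩
    r * (lipschitzConstant r q * ∣ x - y ∣) + ∣ x - y ∣ * coefficientBound r q
      ≡⟨ solve 4 (λ r l d b → r :* (l :* d) :+ d :* b := (r :* l :+ b) :* d) refl r (lipschitzConstant r q) ∣ x - y ∣ (coefficientBound r q) ⟩
    (r * lipschitzConstant r q + coefficientBound r q) * ∣ x - y ∣ ∎
    where
    open ≤-Reasoning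
    qx qy : ℚ
    qx = evalQ q x
    qy = evalQ q y

*-1/suc≤1/suc : ∀ {c M e i} → c ≤ ℕtoℚ M → M ℕ.* suc e ℕ.≤ i → c * 1/suc i ≤ 1/suc e
*-1/suc≤1/suc {c} {M} {e} {i} c≤M Me≤i = begin
  c * 1/suc i                      ≤⟨ *-monoʳ-≤-0≤ (0≤fraction 1 i) c≤M ⟩
  ℕtoℚ M * 1/suc i                 ≡⟨ fraction-* M 0 1 i ⟩
  ℤ.+ (M ℕ.* 1) / (1 ℕ.* suc i)    ≤⟨ fraction-≤ (M ℕ.* 1) (i ℕ.+ 0) 1 e M*1*e≤1*i ⟩
  1/suc e                          ∎
  where
  open ≤-Reasoning
  M*1*e≤1*i : M ℕ.* 1 ℕ.* suc e ℕ.≤ 1 ℕ.* suc (i ℕ.+ 0)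
  M*1*e≤1*i = subst₂ ℕ._≤_ (cong (ℕ._* suc e) (sym (ℕP.*-identityʳ M)))
                (sym (trans (ℕP.*-identityˡ _) (cong suc (ℕP.+-identityʳ i))))
                (ℕP.≤-trans Me≤i (ℕP.n≤1+n i))

p≤p+1/suc : ∀ p d → p ≤ p + 1/suc d
p≤p+1/suc p d = ≤-by-difference (1/suc d) (0≤fraction 1 d) (solve 2 (λ p δ → (p :+ δ) :- p := δ) refl p (1/suc d))

hasRealRootIn-factor : ∀ {a b} (g h p : Poly) → 0ℚ ≤ a → (∀ x → evalQ p x ≡ evalQ g x * evalQ h x) →
                       HasRealRootIn a b h → HasRealRootIn a b p
hasRealRootIn-factor {a} {b} g h p 0≤a p≡gh (q , regular , (N , d , between) , h-vanishes) =
  q , regular , (N , d , between) , p-vanishes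
  where
  open ≤-Reasoning
  B : ℚ
  B = coefficientBound b g
  M : ℕ
  M = proj₁ (archimedean B)
  ∣q∣≤b : ∀ i → N ℕ.≤ i → ∣ q i ∣ ≤ b
  ∣q∣≤b i N≤i = begin
    ∣ q i ∣          ≡⟨ 0≤p⇒∣p∣≡p (≤-trans 0≤a (≤-trans (p≤p+1/suc a d) a+δ≤qi)) ⟩
    q i              ≤⟨ p≤p+1/suc (q i) d ⟩
    q i + 1/suc d    ≤⟨ qi+δ≤b ⟩
    b                ∎
    where
    a+δ≤qi : a + 1/suc d ≤ q i
    a+δ≤qi = proj₁ (between i N≤i)
    qi+δ≤b : q i + 1/suc d ≤ b
    qi+δ≤b = proj₂ (between i N≤i)
  0≤b : 0ℚ ≤ b
  0≤b = ≤-trans (0≤∣p∣ (q N)) (∣q∣≤b N ℕP.≤-refl)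
  p-vanishes : VanishesAt p q
  p-vanishes e = N ℕ.⊔ Nh , λ i N⊔Nh≤i → begin
    ∣ evalQ p (q i) ∣                       ≡⟨ cong ∣_∣ (p≡gh (q i)) ⟩
    ∣ evalQ g (q i) * evalQ h (q i) ∣       ≡⟨ ∣p*q∣≡∣p∣*∣q∣ (evalQ g (q i)) (evalQ h (q i)) ⟩
    ∣ evalQ g (q i) ∣ * ∣ evalQ h (q i) ∣   ≤⟨ *-mono-≤-0≤ (0≤∣p∣ _) (0≤∣p∣ _) (∣evalQ∣≤coefficientBound 0≤b g (∣q∣≤b i (ℕP.m⊔n≤o⇒m≤o N Nh N⊔Nh≤i))) (proj₂ (h-vanishes e′) i (ℕP.m⊔n≤o⇒n≤o N Nh N⊔Nh≤i)) ⟩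
    B * 1/suc e′                             ≤⟨ *-1/suc≤1/suc {B} {M} {e} {e′} (proj₂ (archimedean B)) ℕP.≤-refl ⟩
    1/suc e                                  ∎
    where
    e′ Nh : ℕ
    e′ = M ℕ.* suc e
    Nh = proj₁ (h-vanishes e′)

module Bisection (h : Poly) (h[1]≥1 : 1ℚ ≤ evalQ h 1ℚ) (h[2]≤-1 : evalQ h (ℕtoℚ 2) ≤ - 1ℚ) where
  open ≤-Reasoning

  two half : ℚ
  two = ℕtoℚ 2
  half = ℤ.+ 1 / 2

  L : ℚ
  L = lipschitzConstant two h
  M : ℕ
  M = proj₁ (archimedean L)
  D : ℕ
  D = suc (2 ℕ.* M)
  δ : ℚ
  δ = 1/suc D

  0≤two : 0ℚ ≤ two
  0≤two = 0≤fraction 2 0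
  0≤δ : 0ℚ ≤ δ
  0≤δ = 0≤fraction 1 D
  0≤half : 0ℚ ≤ half
  0≤half = 0≤fraction 1 1
  δ≤half : δ ≤ half
  δ≤half = fraction-≤ 1 D 1 1 (s≤s (s≤s z≤n))

  -- δ is chosen so small that h moves by at most 1/2 over a distance δ, whence the margins 1 and -1.
  Lδ≤half : L * δ ≤ half
  Lδ≤half = *-1/suc≤1/suc {L} {M} {1} {D} (proj₂ (archimedean L))
    (subst (ℕ._≤ D) (ℕP.*-comm 2 M) (ℕP.n≤1+n (2 ℕ.* M)))

  a₀ b₀ : ℚ
  a₀ = 1ℚ + δ
  b₀ = two - δ

  a₀≤b₀ : a₀ ≤ b₀
  a₀≤b₀ = ≤-by-difference ((half - δ) + (half - δ)) (+-mono-≤ (p≤q⇒0≤q-p δ≤half) (p≤q⇒0≤q-p δ≤half))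
            (solve 1 (λ d → (con two :- d) :- (con 1ℚ :+ d) := (con half :- d) :+ (con half :- d)) refl δ)

  ∣x∣≤two : ∀ {x} → a₀ ≤ x → x ≤ b₀ → ∣ x ∣ ≤ two
  ∣x∣≤two {x} a₀≤x x≤b₀ = begin
    ∣ x ∣ ≡⟨ 0≤p⇒∣p∣≡p (≤-trans (≤-trans 0≤δ (≤-by-difference 1ℚ (0≤fraction 1 0) (solve 1 (λ d → (con 1ℚ :+ d) :- d := con 1ℚ) refl δ))) a₀≤x) ⟩
    x     ≤⟨ x≤b₀ ⟩
    b₀    ≤⟨ ≤-by-difference δ 0≤δ (solve 1 (λ d → con two :- (con two :- d) := d) refl δ) ⟩
    two   ∎

  ∣1∣≤two : ∣ 1ℚ ∣ ≤ two
  ∣1∣≤two = fraction-≤ 1 0 2 0 (s≤s z≤n)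

  ∣two∣≤two : ∣ two ∣ ≤ two
  ∣two∣≤two = ≤-refl

  ∣h-h∣≤L∣x-y∣ : ∀ {x y} → ∣ x ∣ ≤ two → ∣ y ∣ ≤ two → ∣ evalQ h x - evalQ h y ∣ ≤ L * ∣ x - y ∣
  ∣h-h∣≤L∣x-y∣ = evalQ-lipschitz 0≤two h

  0<h[a₀] : 0ℚ < evalQ h a₀
  0<h[a₀] = <-≤-trans (positive⁻¹ half) (≤-by-difference ((h1 - 1ℚ) + (half - (h1 - ha₀)))
              (+-mono-≤ (p≤q⇒0≤q-p h[1]≥1) (p≤q⇒0≤q-p drop≤half))
              (solve 2 (λ a b → a :- con half := (b :- con 1ℚ) :+ (con half :- (b :- a))) refl ha₀ h1))
    where
    h1 ha₀ : ℚ
    h1 = evalQ h 1ℚ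
    ha₀ = evalQ h a₀
    drop≤half : h1 - ha₀ ≤ half
    drop≤half = begin
      h1 - ha₀             ≤⟨ p≤∣p∣ _ ⟩
      ∣ h1 - ha₀ ∣         ≤⟨ ∣h-h∣≤L∣x-y∣ ∣1∣≤two (∣x∣≤two ≤-refl a₀≤b₀) ⟩
      L * ∣ 1ℚ - a₀ ∣      ≡⟨ cong (λ z → L * z) (trans (∣p-q∣≡∣q-p∣ 1ℚ a₀) (cong ∣_∣ (solve 1 (λ d → (con 1ℚ :+ d) :- con 1ℚ := d) refl δ))) ⟩
      L * ∣ δ ∣            ≡⟨ cong (L *_) (0≤p⇒∣p∣≡p 0≤δ) ⟩
      L * δ                ≤⟨ Lδ≤half ⟩
      half                 ∎

  h[b₀]≤0 : evalQ h b₀ ≤ 0ℚ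
  h[b₀]≤0 = ≤-by-difference ((- 1ℚ - h2) + (half - (hb₀ - h2)) + (1ℚ - half))
              (+-mono-≤ (+-mono-≤ (p≤q⇒0≤q-p h[2]≤-1) (p≤q⇒0≤q-p rise≤half)) (p≤q⇒0≤q-p (fraction-≤ 1 1 1 0 (s≤s z≤n))))
              (solve 2 (λ a b → con 0ℚ :- a := ((:- con 1ℚ) :- b) :+ (con half :- (a :- b)) :+ (con 1ℚ :- con half)) refl hb₀ h2)
    where
    h2 hb₀ : ℚ
    h2 = evalQ h two
    hb₀ = evalQ h b₀
    rise≤half : hb₀ - h2 ≤ half
    rise≤half = begin
      hb₀ - h2             ≤⟨ p≤∣p∣ _ ⟩
      ∣ hb₀ - h2 ∣         ≤⟨ ∣h-h∣≤L∣x-y∣ (∣x∣≤two a₀≤b₀ ≤-refl) ∣two∣≤two ⟩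
      L * ∣ b₀ - two ∣     ≡⟨ cong (λ z → L * ∣ z ∣) (solve 1 (λ d → (con two :- d) :- con two := :- d) refl δ) ⟩
      L * ∣ - δ ∣          ≡⟨ cong (L *_) (trans (∣-p∣≡∣p∣ δ) (0≤p⇒∣p∣≡p 0≤δ)) ⟩
      L * δ                ≤⟨ Lδ≤half ⟩
      half                 ∎

  record Bracket (a b : ℚ) : Set where
    field
      a₀≤a : a₀ ≤ a
      a≤b : a ≤ b
      b≤b₀ : b ≤ b₀
      0<h[a] : 0ℚ < evalQ h a
      h[b]≤0 : evalQ h b ≤ 0ℚ

  mid : ℚ → ℚ → ℚ
  mid a b = (a + b) * half

  halve : ℚ × ℚ → ℚ × ℚ
  halve (a , b) with 0ℚ <? evalQ h (mid a b)
  ... | yes _ = mid a b , b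
  ... | no _ = a , mid a b

  record Refines (a b a′ b′ : ℚ) : Set where
    field
      bracket : Bracket a′ b′
      a≤a′ : a ≤ a′
      b′≤b : b′ ≤ b
      halved : b′ - a′ ≡ (b - a) * half

  a≤mid : ∀ {a b} → a ≤ b → a ≤ mid a b
  a≤mid {a} {b} a≤b = ≤-by-difference ((b - a) * half) (0≤* (p≤q⇒0≤q-p a≤b) 0≤half)
    (solve 2 (λ a b → (a :+ b) :* con half :- a := (b :- a) :* con half) refl a b)

  mid≤b : ∀ {a b} → a ≤ b → mid a b ≤ b
  mid≤b {a} {b} a≤b = ≤-by-difference ((b - a) * half) (0≤* (p≤q⇒0≤q-p a≤b) 0≤half)
    (solve 2 (λ a b → b :- (a :+ b) :* con half := (b :- a) :* con half) refl a b)

  halve-refines : ∀ {a b} → Bracket a b → Refines a b (proj₁ (halve (a , b))) (proj₂ (halve (a , b)))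
  halve-refines {a} {b} br with 0ℚ <? evalQ h (mid a b)
  ... | yes 0<h[mid] = record
    { bracket = record { a₀≤a = ≤-trans a₀≤a (a≤mid a≤b) ; a≤b = mid≤b a≤b ; b≤b₀ = b≤b₀ ; 0<h[a] = 0<h[mid] ; h[b]≤0 = h[b]≤0 }
    ; a≤a′ = a≤mid a≤b ; b′≤b = ≤-refl
    ; halved = solve 2 (λ a b → b :- (a :+ b) :* con half := (b :- a) :* con half) refl a b }
    where open Bracket br
  ... | no 0≮h[mid] = record
    { bracket = record { a₀≤a = a₀≤a ; a≤b = a≤mid a≤b ; b≤b₀ = ≤-trans (mid≤b a≤b) b≤b₀ ; 0<h[a] = 0<h[a] ; h[b]≤0 = ≮⇒≥ 0≮h[mid] }
    ; a≤a′ = ≤-refl ; b′≤b = mid≤b a≤b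
    ; halved = solve 2 (λ a b → (a :+ b) :* con half :- a := (b :- a) :* con half) refl a b }
    where open Bracket br

  interval : ℕ → ℚ × ℚ
  interval zero = a₀ , b₀
  interval (suc i) = halve (interval i)

  lo hi : ℕ → ℚ
  lo i = proj₁ (interval i)
  hi i = proj₂ (interval i)

  bracket : ∀ i → Bracket (lo i) (hi i)
  refines : ∀ i → Refines (lo i) (hi i) (lo (suc i)) (hi (suc i))
  bracket zero = record { a₀≤a = ≤-refl ; a≤b = a₀≤b₀ ; b≤b₀ = ≤-refl ; 0<h[a] = 0<h[a₀] ; h[b]≤0 = h[b₀]≤0 }
  bracket (suc i) = Refines.bracket (refines i)
  refines i = halve-refines (bracket i)

  lo-mono : ∀ i n → lo i ≤ lo (n ℕ.+ i)
  lo-mono i zero = ≤-refl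
  lo-mono i (suc n) = ≤-trans (lo-mono i n) (Refines.a≤a′ (refines (n ℕ.+ i)))

  hi-mono : ∀ i n → hi (n ℕ.+ i) ≤ hi i
  hi-mono i zero = ≤-refl
  hi-mono i (suc n) = ≤-trans (Refines.b′≤b (refines (n ℕ.+ i))) (hi-mono i n)

  width≤1/suc : ∀ i → hi i - lo i ≤ 1/suc i
  width≤1/suc zero = ≤-by-difference (δ + δ) (+-mono-≤ 0≤δ 0≤δ) (solve 1 (λ d → con 1ℚ :- ((con two :- d) :- (con 1ℚ :+ d)) := d :+ d) refl δ)
  width≤1/suc (suc i) = begin
    hi (suc i) - lo (suc i)          ≡⟨ Refines.halved (refines i) ⟩
    (hi i - lo i) * half             ≤⟨ *-monoʳ-≤-0≤ 0≤half (width≤1/suc i) ⟩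
    1/suc i * half                   ≡⟨ fraction-* 1 i 1 1 ⟩
    ℤ.+ (1 ℕ.* 1) / (suc i ℕ.* 2)    ≤⟨ fraction-≤ 1 (suc (i ℕ.* 2)) 1 (suc i) (s≤s (s≤s (subst₂ ℕ._≤_ (sym (ℕP.+-identityʳ i)) (sym (ℕP.+-identityʳ (i ℕ.* 2))) (ℕP.m≤m*n i 2)))) ⟩
    1/suc (suc i)                    ∎

  ∣lo-lo∣≤1/suc : ∀ {i j} → i ℕ.≤ j → ∣ lo j - lo i ∣ ≤ 1/suc i
  ∣lo-lo∣≤1/suc {i} {j} i≤j = begin
    ∣ lo j - lo i ∣ ≡⟨ 0≤p⇒∣p∣≡p (p≤q⇒0≤q-p lo[i]≤lo[j]) ⟩
    lo j - lo i     ≤⟨ +-monoˡ-≤ (- lo i) (≤-trans (Bracket.a≤b (bracket j)) hi[j]≤hi[i]) ⟩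
    hi i - lo i     ≤⟨ width≤1/suc i ⟩
    1/suc i         ∎
    where
    j≡j-i+i : (j ℕ.∸ i) ℕ.+ i ≡ j
    j≡j-i+i = ℕP.m∸n+n≡m i≤j
    lo[i]≤lo[j] : lo i ≤ lo j
    lo[i]≤lo[j] = subst (λ z → lo i ≤ lo z) j≡j-i+i (lo-mono i (j ℕ.∸ i))
    hi[j]≤hi[i] : hi j ≤ hi i
    hi[j]≤hi[i] = subst (λ z → hi z ≤ hi i) j≡j-i+i (hi-mono i (j ℕ.∸ i))

  lo-regular : IsRegular lo
  lo-regular i j with ℕP.≤-total i j
  ... | inj₁ i≤j = begin
    ∣ lo i - lo j ∣       ≡⟨ ∣p-q∣≡∣q-p∣ (lo i) (lo j) ⟩
    ∣ lo j - lo i ∣       ≤⟨ ∣lo-lo∣≤1/suc i≤j ⟩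
    1/suc i               ≤⟨ p≤p+1/suc (1/suc i) j ⟩
    1/suc i + 1/suc j     ∎
  ... | inj₂ j≤i = begin
    ∣ lo i - lo j ∣       ≤⟨ ∣lo-lo∣≤1/suc j≤i ⟩
    1/suc j               ≤⟨ p≤p+1/suc (1/suc j) i ⟩
    1/suc j + 1/suc i     ≡⟨ +-comm (1/suc j) (1/suc i) ⟩
    1/suc i + 1/suc j     ∎

  lo-between : StrictlyBetween (ℕtoℚ 1) two lo
  lo-between = 0 , D , λ i _ → Bracket.a₀≤a (bracket i) , (begin
    lo i + δ   ≤⟨ +-monoˡ-≤ δ (≤-trans (Bracket.a≤b (bracket i)) (Bracket.b≤b₀ (bracket i))) ⟩
    b₀ + δ     ≡⟨ solve 1 (λ d → (con two :- d) :+ d := con two) refl δ ⟩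
    two        ∎)

  -- h(lo i) > 0 ≥ h(hi i), so |h(lo i)| is at most the variation of h across the bracket.
  ∣h[lo]∣≤L/suc : ∀ i → ∣ evalQ h (lo i) ∣ ≤ L * 1/suc i
  ∣h[lo]∣≤L/suc i = begin
    ∣ evalQ h (lo i) ∣                  ≡⟨ 0≤p⇒∣p∣≡p (<⇒≤ 0<h[a]) ⟩
    evalQ h (lo i)                      ≤⟨ ≤-by-difference (- evalQ h (hi i)) (neg-antimono-≤ h[b]≤0) (solve 2 (λ a b → (a :- b) :- a := :- b) refl (evalQ h (lo i)) (evalQ h (hi i))) ⟩
    evalQ h (lo i) - evalQ h (hi i)     ≤⟨ p≤∣p∣ _ ⟩
    ∣ evalQ h (lo i) - evalQ h (hi i) ∣ ≤⟨ ∣h-h∣≤L∣x-y∣ (∣x∣≤two a₀≤a (≤-trans a≤b b≤b₀)) (∣x∣≤two (≤-trans a₀≤a a≤b) b≤b₀) ⟩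
    L * ∣ lo i - hi i ∣                 ≡⟨ cong (L *_) (trans (∣p-q∣≡∣q-p∣ (lo i) (hi i)) (0≤p⇒∣p∣≡p (p≤q⇒0≤q-p a≤b))) ⟩
    L * (hi i - lo i)                   ≤⟨ *-monoˡ-≤-0≤ (0≤lipschitzConstant 0≤two h) (width≤1/suc i) ⟩
    L * 1/suc i                         ∎
    where open Bracket (bracket i)

  h-vanishes-at-lo : VanishesAt h lo
  h-vanishes-at-lo e = M ℕ.* suc e , λ i Me≤i →
    ≤-trans (∣h[lo]∣≤L/suc i) (*-1/suc≤1/suc {L} {M} {e} {i} (proj₂ (archimedean L)) Me≤i)

sign-change⇒root : ∀ h → 1ℚ ≤ evalQ h 1ℚ → evalQ h (ℕtoℚ 2) ≤ - 1ℚ → HasRealRootIn (ℕtoℚ 1) (ℕtoℚ 2) h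
sign-change⇒root h h[1]≥1 h[2]≤-1 = lo , lo-regular , lo-between , h-vanishes-at-lo
  where open Bisection h h[1]≥1 h[2]≤-1

open ≡-Reasoning

𝟙 : Bool → ℚ
𝟙 true = 1ℚ
𝟙 false = 0ℚ

𝟙-∧ : ∀ a b → 𝟙 (a ∧ b) ≡ 𝟙 a * 𝟙 b
𝟙-∧ true b = sym (*-identityˡ (𝟙 b))
𝟙-∧ false b = sym (*-zeroˡ (𝟙 b))

_≠ᵇ_ : ∀ {k} → Fin k → Fin k → Bool
c ≠ᵇ a = not ⌊ c Fin.≟ a ⌋

≠ᵇ-refl : ∀ {k} (a : Fin k) → (a ≠ᵇ a) ≡ false
≠ᵇ-refl a with a Fin.≟ a
... | yes _ = refl
... | no a≢a = ⊥-elim (a≢a refl)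

≢⇒≠ᵇ : ∀ {k} {c a : Fin k} → c ≢ a → (c ≠ᵇ a) ≡ true
≢⇒≠ᵇ {c = c} {a} c≢a with c Fin.≟ a
... | yes c≡a = ⊥-elim (c≢a c≡a)
... | no _ = refl

≠ᵇ⇒≢ : ∀ {k} {c a : Fin k} → (c ≠ᵇ a) ≡ true → c ≢ a
≠ᵇ⇒≢ {c = c} {a} e c≡a with c Fin.≟ a
≠ᵇ⇒≢ () c≡a | yes _
... | no c≢a = c≢a c≡a

∑-const : ∀ k y → ∑[ c < k ] y ≡ ℕtoℚ k * y
∑-const zero y = sym (*-zeroˡ y)
∑-const (suc k) y = begin
  y + ∑[ c < k ] y       ≡⟨ cong (y +_) (∑-const k y) ⟩
  y + ℕtoℚ k * y         ≡⟨ solve 2 (λ y n → y :+ n :* y := (con 1ℚ :+ n) :* y) refl y (ℕtoℚ k) ⟩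
  (1ℚ + ℕtoℚ k) * y      ≡⟨ cong (_* y) (ℕtoℚ-suc k) ⟨
  ℕtoℚ (suc k) * y       ∎

∑-except : ∀ {k} (a : Fin k) (f : Fin k → ℚ) → ∑[ c < k ] (𝟙 (c ≠ᵇ a) * f c) ≡ sum f - f a
∑-except {suc k} a f = begin
  ∑[ c < suc k ] (𝟙 (c ≠ᵇ a) * f c)                           ≡⟨ sum-remove {i = a} (λ c → 𝟙 (c ≠ᵇ a) * f c) ⟩
  𝟙 (a ≠ᵇ a) * f a + ∑[ c < k ] (𝟙 (punchIn a c ≠ᵇ a) * f (punchIn a c))
    ≡⟨ cong₂ (λ u v → 𝟙 u * f a + v) (≠ᵇ-refl a)
             (sum-cong-≗ λ c → trans (cong (λ u → 𝟙 u * f (punchIn a c)) (≢⇒≠ᵇ (punchInᵢ≢i a c))) (*-identityˡ _)) ⟩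
  0ℚ * f a + ∑[ c < k ] f (punchIn a c)                         ≡⟨ solve 2 (λ x r → con 0ℚ :* x :+ r := (x :+ r) :- x) refl (f a) (∑[ c < k ] f (punchIn a c)) ⟩
  (f a + ∑[ c < k ] f (punchIn a c)) - f a                       ≡⟨ cong (_- f a) (sum-remove {i = a} f) ⟨
  sum f - f a                                                    ∎

private
  punchIn≢ : ∀ {k} {a b : Fin (suc k)} (a≢b : a ≢ b) {c} → c ≢ punchOut a≢b → punchIn a c ≢ b
  punchIn≢ {a = a} a≢b c≢b′ e = c≢b′ (punchIn-injective a _ _ (trans e (sym (punchIn-punchOut a≢b))))

  ℕtoℚ-suc-∸ : ∀ k y j → (ℕtoℚ k - j) * y ≡ (ℕtoℚ (suc k) - (1ℚ + j)) * y
  ℕtoℚ-suc-∸ k y j = begin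
    (ℕtoℚ k - j) * y                 ≡⟨ solve 3 (λ n j y → (n :- j) :* y := ((con 1ℚ :+ n) :- (con 1ℚ :+ j)) :* y) refl (ℕtoℚ k) j y ⟩
    ((1ℚ + ℕtoℚ k) - (1ℚ + j)) * y   ≡⟨ cong (λ n → (n - (1ℚ + j)) * y) (ℕtoℚ-suc k) ⟨
    (ℕtoℚ (suc k) - (1ℚ + j)) * y    ∎

∑-constant-off₁ : ∀ {k} (a : Fin k) (f : Fin k → ℚ) {y} → (∀ c → c ≢ a → f c ≡ y) →
                  sum f ≡ f a + (ℕtoℚ k - 1ℚ) * y
∑-constant-off₁ {suc k} a f {y} off = begin
  sum f                          ≡⟨ sum-remove {i = a} f ⟩
  f a + ∑[ c < k ] f (punchIn a c) ≡⟨ cong (f a +_) (sum-cong-≗ λ c → off (punchIn a c) (punchInᵢ≢i a c)) ⟩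
  f a + ∑[ c < k ] y             ≡⟨ cong (f a +_) (trans (∑-const k y) (solve 2 (λ n y → n :* y := (n :- con 0ℚ) :* y) refl (ℕtoℚ k) y)) ⟩
  f a + (ℕtoℚ k - 0ℚ) * y        ≡⟨ cong (f a +_) (ℕtoℚ-suc-∸ k y 0ℚ) ⟩
  f a + (ℕtoℚ (suc k) - 1ℚ) * y  ∎

∑-constant-off₂ : ∀ {k} (a b : Fin k) (f : Fin k → ℚ) {y} → a ≢ b → (∀ c → c ≢ a → c ≢ b → f c ≡ y) →
                  sum f ≡ f a + f b + (ℕtoℚ k - ℕtoℚ 2) * y
∑-constant-off₂ {suc k} a b f {y} a≢b off = begin
  sum f                                  ≡⟨ sum-remove {i = a} f ⟩
  f a + ∑[ c < k ] f (punchIn a c)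
    ≡⟨ cong (f a +_) (∑-constant-off₁ (punchOut a≢b) (f ∘ punchIn a)
         λ c c≢b′ → off (punchIn a c) (punchInᵢ≢i a c) (punchIn≢ a≢b c≢b′)) ⟩
  f a + (f (punchIn a (punchOut a≢b)) + (ℕtoℚ k - 1ℚ) * y)
    ≡⟨ cong₂ (λ u v → f a + (f u + v)) (punchIn-punchOut a≢b) (ℕtoℚ-suc-∸ k y 1ℚ) ⟩
  f a + (f b + (ℕtoℚ (suc k) - ℕtoℚ 2) * y) ≡⟨ +-assoc (f a) (f b) _ ⟨
  f a + f b + (ℕtoℚ (suc k) - ℕtoℚ 2) * y  ∎

∑-constant-off₃ : ∀ {k} (a b d : Fin k) (f : Fin k → ℚ) {y} → a ≢ b → a ≢ d → b ≢ d →
                  (∀ c → c ≢ a → c ≢ b → c ≢ d → f c ≡ y) →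
                  sum f ≡ f a + f b + f d + (ℕtoℚ k - ℕtoℚ 3) * y
∑-constant-off₃ {suc k} a b d f {y} a≢b a≢d b≢d off = begin
  sum f                                  ≡⟨ sum-remove {i = a} f ⟩
  f a + ∑[ c < k ] f (punchIn a c)
    ≡⟨ cong (f a +_) (∑-constant-off₂ (punchOut a≢b) (punchOut a≢d) (f ∘ punchIn a) b′≢d′
         λ c c≢b′ c≢d′ → off (punchIn a c) (punchInᵢ≢i a c) (punchIn≢ a≢b c≢b′) (punchIn≢ a≢d c≢d′)) ⟩
  f a + (f (punchIn a (punchOut a≢b)) + f (punchIn a (punchOut a≢d)) + (ℕtoℚ k - ℕtoℚ 2) * y)
    ≡⟨ cong₂ (λ u v → f a + (f u + f (punchIn a (punchOut a≢d)) + v)) (punchIn-punchOut a≢b) (ℕtoℚ-suc-∸ k y (ℕtoℚ 2)) ⟩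
  f a + (f b + f (punchIn a (punchOut a≢d)) + (ℕtoℚ (suc k) - ℕtoℚ 3) * y)
    ≡⟨ cong (λ u → f a + (f b + f u + (ℕtoℚ (suc k) - ℕtoℚ 3) * y)) (punchIn-punchOut a≢d) ⟩
  f a + (f b + f d + (ℕtoℚ (suc k) - ℕtoℚ 3) * y)
    ≡⟨ solve 4 (λ p q r s → p :+ (q :+ r :+ s) := p :+ q :+ r :+ s) refl (f a) (f b) (f d) _ ⟩
  f a + f b + f d + (ℕtoℚ (suc k) - ℕtoℚ 3) * y ∎
  where
  b′≢d′ : punchOut a≢b ≢ punchOut a≢d
  b′≢d′ e = b≢d (trans (sym (punchIn-punchOut a≢b)) (trans (cong (punchIn a) e) (punchIn-punchOut a≢d)))

∑-distrib-sub : ∀ {k} (f g : Fin k → ℚ) → ∑[ c < k ] (f c - g c) ≡ sum f - sum g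
∑-distrib-sub {zero} f g = refl
∑-distrib-sub {suc k} f g = begin
  (f zero - g zero) + ∑[ c < k ] (f (suc c) - g (suc c))      ≡⟨ cong ((f zero - g zero) +_) (∑-distrib-sub (f ∘ suc) (g ∘ suc)) ⟩
  (f zero - g zero) + (sum (f ∘ suc) - sum (g ∘ suc))         ≡⟨ solve 4 (λ a b x y → (a :- b) :+ (x :- y) := (a :+ x) :- (b :+ y)) refl (f zero) (g zero) (sum (f ∘ suc)) (sum (g ∘ suc)) ⟩
  (f zero + sum (f ∘ suc)) - (g zero + sum (g ∘ suc))         ∎

∑-except₂ : ∀ {k} (a b : Fin k) (f : Fin k → Fin k → ℚ) →
  ∑[ y < k ] (𝟙 (y ≠ᵇ a) * ∑[ z < k ] (𝟙 (z ≠ᵇ b) * f y z))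
    ≡ ∑[ y < k ] ∑[ z < k ] f y z - ∑[ y < k ] f y b - ∑[ z < k ] f a z + f a b
∑-except₂ {k} a b f = begin
  ∑[ y < k ] (𝟙 (y ≠ᵇ a) * ∑[ z < k ] (𝟙 (z ≠ᵇ b) * f y z))
    ≡⟨ sum-cong-≗ (λ y → cong (𝟙 (y ≠ᵇ a) *_) (∑-except b (f y))) ⟩
  ∑[ y < k ] (𝟙 (y ≠ᵇ a) * (sum (f y) - f y b))
    ≡⟨ ∑-except a (λ y → sum (f y) - f y b) ⟩
  ∑[ y < k ] (sum (f y) - f y b) - (sum (f a) - f a b)
    ≡⟨ cong (_- (sum (f a) - f a b)) (∑-distrib-sub (λ y → sum (f y)) (λ y → f y b)) ⟩
  (∑[ y < k ] sum (f y) - ∑[ y < k ] f y b) - (sum (f a) - f a b)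
    ≡⟨ solve 4 (λ T C R x → (T :- C) :- (R :- x) := T :- C :- R :+ x) refl (∑[ y < k ] sum (f y)) (∑[ y < k ] f y b) (sum (f a)) (f a b) ⟩
  ∑[ y < k ] ∑[ z < k ] f y z - ∑[ y < k ] f y b - ∑[ z < k ] f a z + f a b ∎

infixr 8 _^_
_^_ : ℚ → ℕ → ℚ
x ^ zero = 1ℚ
x ^ suc n = x * x ^ n

^-+ : ∀ x m n → x ^ (m ℕ.+ n) ≡ x ^ m * x ^ n
^-+ x zero n = sym (*-identityˡ _)
^-+ x (suc m) n = trans (cong (x *_) (^-+ x m n)) (sym (*-assoc x _ _))

^-double : ∀ x m → x ^ (2 ℕ.* m) ≡ (x * x) ^ m
^-double x zero = refl
^-double x (suc m) = begin
  x ^ (2 ℕ.* suc m)         ≡⟨ cong (x ^_) (ℕP.*-distribˡ-+ 2 1 m) ⟩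
  x ^ (2 ℕ.+ 2 ℕ.* m)       ≡⟨ ^-+ x 2 (2 ℕ.* m) ⟩
  x ^ 2 * x ^ (2 ℕ.* m)     ≡⟨ cong₂ _*_ (cong (x *_) (*-identityʳ x)) (^-double x m) ⟩
  (x * x) * (x * x) ^ m     ∎

1^n≡1 : ∀ n → 1ℚ ^ n ≡ 1ℚ
1^n≡1 zero = refl
1^n≡1 (suc n) = trans (*-identityˡ _) (1^n≡1 n)

0^suc≡0 : ∀ n → 0ℚ ^ suc n ≡ 0ℚ
0^suc≡0 n = *-zeroˡ (0ℚ ^ n)

infixl 6 _⊕_
_⊕_ : Poly → Poly → Poly
[] ⊕ q = q
(a ∷ p) ⊕ [] = a ∷ p
(a ∷ p) ⊕ (b ∷ q) = (a + b) ∷ (p ⊕ q)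

evalQ-⊕ : ∀ p q x → evalQ (p ⊕ q) x ≡ evalQ p x + evalQ q x
evalQ-⊕ [] q x = sym (+-identityˡ _)
evalQ-⊕ (a ∷ p) [] x = sym (+-identityʳ _)
evalQ-⊕ (a ∷ p) (b ∷ q) x = begin
  (a + b) + x * evalQ (p ⊕ q) x          ≡⟨ cong (λ z → (a + b) + x * z) (evalQ-⊕ p q x) ⟩
  (a + b) + x * (evalQ p x + evalQ q x)  ≡⟨ solve 5 (λ a b x u v → (a :+ b) :+ x :* (u :+ v) := (a :+ x :* u) :+ (b :+ x :* v)) refl a b x (evalQ p x) (evalQ q x) ⟩
  (a + x * evalQ p x) + (b + x * evalQ q x) ∎

length-⊕ : ∀ p q → length (p ⊕ q) ≡ length p ℕ.⊔ length q
length-⊕ [] q = refl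
length-⊕ (a ∷ p) [] = refl
length-⊕ (a ∷ p) (b ∷ q) = cong suc (length-⊕ p q)

scale : ℚ → Poly → Poly
scale c = map (c *_)

evalQ-scale : ∀ c p x → evalQ (scale c p) x ≡ c * evalQ p x
evalQ-scale c [] x = sym (*-zeroʳ c)
evalQ-scale c (a ∷ p) x = trans (cong (λ z → c * a + x * z) (evalQ-scale c p x))
  (solve 4 (λ c a x u → c :* a :+ x :* (c :* u) := c :* (a :+ x :* u)) refl c a x (evalQ p x))

infixl 7 _⊗_
_⊗_ : Poly → Poly → Poly
[] ⊗ q = []
(a ∷ p) ⊗ q = scale a q ⊕ (0ℚ ∷ p ⊗ q)

evalQ-⊗ : ∀ p q x → evalQ (p ⊗ q) x ≡ evalQ p x * evalQ q x
evalQ-⊗ [] q x = sym (*-zeroˡ (evalQ q x))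
evalQ-⊗ (a ∷ p) q x = begin
  evalQ (scale a q ⊕ (0ℚ ∷ p ⊗ q)) x                    ≡⟨ evalQ-⊕ (scale a q) _ x ⟩
  evalQ (scale a q) x + (0ℚ + x * evalQ (p ⊗ q) x)      ≡⟨ cong₂ (λ u v → u + (0ℚ + x * v)) (evalQ-scale a q x) (evalQ-⊗ p q x) ⟩
  a * evalQ q x + (0ℚ + x * (evalQ p x * evalQ q x))    ≡⟨ solve 4 (λ a x u v → a :* v :+ (con 0ℚ :+ x :* (u :* v)) := (a :+ x :* u) :* v) refl a x (evalQ p x) (evalQ q x) ⟩
  (a + x * evalQ p x) * evalQ q x                       ∎

evalQ-constant : ∀ c x → evalQ (c ∷ []) x ≡ c
evalQ-constant c x = trans (cong (c +_) (*-zeroʳ x)) (+-identityʳ c)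

infixl 6 _⊞_ _⊟_
infixl 7 _⊠_
infixr 8 _⊡_

data PolyExpr : Set where
  cst : ℚ → PolyExpr
  var : PolyExpr
  _⊞_ _⊟_ _⊠_ : PolyExpr → PolyExpr → PolyExpr
  _⊡_ : PolyExpr → ℕ → PolyExpr

⟦_⟧ : PolyExpr → ℚ → ℚ
⟦ cst c ⟧ x = c
⟦ var ⟧ x = x
⟦ e ⊞ f ⟧ x = ⟦ e ⟧ x + ⟦ f ⟧ x
⟦ e ⊟ f ⟧ x = ⟦ e ⟧ x - ⟦ f ⟧ x
⟦ e ⊠ f ⟧ x = ⟦ e ⟧ x * ⟦ f ⟧ x
⟦ e ⊡ n ⟧ x = ⟦ e ⟧ x ^ n

toPoly : PolyExpr → Poly
toPoly (cst c) = c ∷ []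
toPoly var = 0ℚ ∷ 1ℚ ∷ []
toPoly (e ⊞ f) = toPoly e ⊕ toPoly f
toPoly (e ⊟ f) = toPoly e ⊕ scale (- 1ℚ) (toPoly f)
toPoly (e ⊠ f) = toPoly e ⊗ toPoly f
toPoly (e ⊡ zero) = 1ℚ ∷ []
toPoly (e ⊡ suc n) = toPoly e ⊗ toPoly (e ⊡ n)

evalQ-toPoly : ∀ e x → evalQ (toPoly e) x ≡ ⟦ e ⟧ x
evalQ-toPoly (cst c) x = evalQ-constant c x
evalQ-toPoly var x = solve 1 (λ x → con 0ℚ :+ x :* (con 1ℚ :+ x :* con 0ℚ) := x) refl x
evalQ-toPoly (e ⊞ f) x = trans (evalQ-⊕ (toPoly e) (toPoly f) x) (cong₂ _+_ (evalQ-toPoly e x) (evalQ-toPoly f x))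
evalQ-toPoly (e ⊟ f) x = begin
  evalQ (toPoly e ⊕ scale (- 1ℚ) (toPoly f)) x       ≡⟨ evalQ-⊕ (toPoly e) _ x ⟩
  evalQ (toPoly e) x + evalQ (scale (- 1ℚ) (toPoly f)) x ≡⟨ cong₂ (λ u v → u + v) (evalQ-toPoly e x) (evalQ-scale (- 1ℚ) (toPoly f) x) ⟩
  ⟦ e ⟧ x + - 1ℚ * evalQ (toPoly f) x                  ≡⟨ cong (λ v → ⟦ e ⟧ x + - 1ℚ * v) (evalQ-toPoly f x) ⟩
  ⟦ e ⟧ x + - 1ℚ * ⟦ f ⟧ x                              ≡⟨ solve 2 (λ u v → u :+ :- con 1ℚ :* v := u :- v) refl (⟦ e ⟧ x) (⟦ f ⟧ x) ⟩
  ⟦ e ⟧ x - ⟦ f ⟧ x                                      ∎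
evalQ-toPoly (e ⊠ f) x = trans (evalQ-⊗ (toPoly e) (toPoly f) x) (cong₂ _*_ (evalQ-toPoly e x) (evalQ-toPoly f x))
evalQ-toPoly (e ⊡ zero) x = evalQ-constant 1ℚ x
evalQ-toPoly (e ⊡ suc n) x = trans (evalQ-⊗ (toPoly e) (toPoly (e ⊡ n)) x) (cong₂ _*_ (evalQ-toPoly e x) (evalQ-toPoly (e ⊡ n) x))

shift : Poly → Poly
shift [] = []
shift (a ∷ q) = (a ∷ []) ⊕ ((0ℚ ∷ shift q) ⊕ shift q)

evalQ-shift : ∀ q x → evalQ (shift q) x ≡ evalQ q (x + 1ℚ)
evalQ-shift [] x = refl
evalQ-shift (a ∷ q) x = begin
  evalQ ((a ∷ []) ⊕ ((0ℚ ∷ shift q) ⊕ shift q)) x              ≡⟨ evalQ-⊕ (a ∷ []) ((0ℚ ∷ shift q) ⊕ shift q) x ⟩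
  evalQ (a ∷ []) x + evalQ ((0ℚ ∷ shift q) ⊕ shift q) x       ≡⟨ cong₂ _+_ (evalQ-constant a x) (evalQ-⊕ (0ℚ ∷ shift q) (shift q) x) ⟩
  a + ((0ℚ + x * evalQ (shift q) x) + evalQ (shift q) x)      ≡⟨ cong (λ z → a + ((0ℚ + x * z) + z)) (evalQ-shift q x) ⟩
  a + ((0ℚ + x * evalQ q (x + 1ℚ)) + evalQ q (x + 1ℚ))        ≡⟨ solve 3 (λ a x u → a :+ ((con 0ℚ :+ x :* u) :+ u) := a :+ (x :+ con 1ℚ) :* u) refl a x (evalQ q (x + 1ℚ)) ⟩
  a + (x + 1ℚ) * evalQ q (x + 1ℚ)                              ∎

length-shift : ∀ q → length (shift q) ≡ length q
length-shift [] = refl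
length-shift (a ∷ q) = begin
  length ((a ∷ []) ⊕ ((0ℚ ∷ shift q) ⊕ shift q))         ≡⟨ length-⊕ (a ∷ []) ((0ℚ ∷ shift q) ⊕ shift q) ⟩
  1 ℕ.⊔ length ((0ℚ ∷ shift q) ⊕ shift q)              ≡⟨ cong (1 ℕ.⊔_) (length-⊕ (0ℚ ∷ shift q) (shift q)) ⟩
  1 ℕ.⊔ (suc (length (shift q)) ℕ.⊔ length (shift q))  ≡⟨ cong (λ z → 1 ℕ.⊔ (suc z ℕ.⊔ z)) (length-shift q) ⟩
  1 ℕ.⊔ (suc (length q) ℕ.⊔ length q)                  ≡⟨ cong (1 ℕ.⊔_) (ℕP.m≥n⇒m⊔n≡m (ℕP.n≤1+n (length q))) ⟩
  1 ℕ.⊔ suc (length q)                                  ≡⟨ ℕP.m≤n⇒m⊔n≡n (s≤s z≤n) ⟩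
  suc (length q)                                        ∎

ℕtoℚ-suc-cancel : ∀ m y → ℕtoℚ (suc m) * y ≡ 0ℚ → y ≡ 0ℚ
ℕtoℚ-suc-cancel m y e = begin
  y                           ≡⟨ *-identityˡ y ⟨
  1ℚ * y                      ≡⟨ cong (_* y) (*-inverseˡ m+1) ⟨
  (1/ m+1 * m+1) * y          ≡⟨ *-assoc (1/ m+1) m+1 y ⟩
  1/ m+1 * (m+1 * y)          ≡⟨ cong (λ z → 1/ m+1 * (z * y)) (normalize-coprime coprime) ⟨
  1/ m+1 * (ℕtoℚ (suc m) * y) ≡⟨ cong (1/ m+1 *_) e ⟩
  1/ m+1 * 0ℚ                 ≡⟨ *-zeroʳ (1/ m+1) ⟩
  0ℚ                          ∎
  where
  coprime : Coprimality.Coprime (suc m) 1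
  coprime = Coprimality.sym (Coprimality.1-coprimeTo (suc m))
  m+1 : ℚ
  m+1 = mkℚ (ℤ.+ suc m) 0 coprime

-- Induction on a length bound: the constant term is p(0) = 0, and the cofactor of x vanishes
-- at every positive integer, so its shift has the same length and vanishes on all of ℕ.
vanishes-on-ℕ⇒zero : ∀ n p → length p ℕ.≤ n → (∀ m → evalQ p (ℕtoℚ m) ≡ 0ℚ) → ∀ x → evalQ p x ≡ 0ℚ
vanishes-on-ℕ⇒zero n [] _ _ x = refl
vanishes-on-ℕ⇒zero (suc n) (a ∷ q) (s≤s len≤n) vanishes x = begin
  a + x * evalQ q x ≡⟨ cong₂ (λ u v → u + x * v) a≡0 (q-vanishes x) ⟩
  0ℚ + x * 0ℚ       ≡⟨ solve 1 (λ x → con 0ℚ :+ x :* con 0ℚ := con 0ℚ) refl x ⟩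
  0ℚ                ∎
  where
  a≡0 : a ≡ 0ℚ
  a≡0 = trans (sym (trans (cong (a +_) (*-zeroˡ (evalQ q 0ℚ))) (+-identityʳ a))) (vanishes 0)
  q-vanishes-at-suc : ∀ m → evalQ q (ℕtoℚ (suc m)) ≡ 0ℚ
  q-vanishes-at-suc m = ℕtoℚ-suc-cancel m _ (begin
    ℕtoℚ (suc m) * evalQ q (ℕtoℚ (suc m))       ≡⟨ +-identityˡ _ ⟨
    0ℚ + ℕtoℚ (suc m) * evalQ q (ℕtoℚ (suc m))  ≡⟨ cong (λ z → z + ℕtoℚ (suc m) * evalQ q (ℕtoℚ (suc m))) a≡0 ⟨
    a + ℕtoℚ (suc m) * evalQ q (ℕtoℚ (suc m))   ≡⟨ vanishes (suc m) ⟩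
    0ℚ                                          ∎)
  shift-vanishes : ∀ y → evalQ (shift q) y ≡ 0ℚ
  shift-vanishes = vanishes-on-ℕ⇒zero n (shift q) (subst (ℕ._≤ n) (sym (length-shift q)) len≤n)
    λ m → trans (evalQ-shift q (ℕtoℚ m)) (trans (cong (evalQ q) (trans (+-comm (ℕtoℚ m) 1ℚ) (sym (ℕtoℚ-suc m)))) (q-vanishes-at-suc m))
  q-vanishes : ∀ y → evalQ q y ≡ 0ℚ
  q-vanishes y = begin
    evalQ q y                ≡⟨ cong (evalQ q) (solve 1 (λ y → y := (y :- con 1ℚ) :+ con 1ℚ) refl y) ⟩
    evalQ q (y - 1ℚ + 1ℚ)    ≡⟨ evalQ-shift q (y - 1ℚ) ⟨
    evalQ (shift q) (y - 1ℚ) ≡⟨ shift-vanishes (y - 1ℚ) ⟩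
    0ℚ                       ∎

agree-on-ℕ⇒agree : ∀ p q → (∀ m → evalQ p (ℕtoℚ m) ≡ evalQ q (ℕtoℚ m)) → ∀ x → evalQ p x ≡ evalQ q x
agree-on-ℕ⇒agree p q agree x = begin
  evalQ p x                       ≡⟨ solve 2 (λ u v → u := (u :- v) :+ v) refl (evalQ p x) (evalQ q x) ⟩
  (evalQ p x - evalQ q x) + evalQ q x ≡⟨ cong (_+ evalQ q x) (trans (sym (evalQ-p⊖q x)) (vanishes-on-ℕ⇒zero _ p⊖q ℕP.≤-refl p⊖q-vanishes x)) ⟩
  0ℚ + evalQ q x                  ≡⟨ +-identityˡ _ ⟩
  evalQ q x                       ∎
  where
  p⊖q : Poly
  p⊖q = p ⊕ scale (- 1ℚ) q
  evalQ-p⊖q : ∀ y → evalQ p⊖q y ≡ evalQ p y - evalQ q y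
  evalQ-p⊖q y = trans (evalQ-⊕ p (scale (- 1ℚ) q) y) (trans (cong (evalQ p y +_) (evalQ-scale (- 1ℚ) q y))
    (solve 2 (λ u v → u :+ :- con 1ℚ :* v := u :- v) refl (evalQ p y) (evalQ q y)))
  p⊖q-vanishes : ∀ m → evalQ p⊖q (ℕtoℚ m) ≡ 0ℚ
  p⊖q-vanishes m = trans (evalQ-p⊖q (ℕtoℚ m)) (trans (cong (_- evalQ q (ℕtoℚ m)) (agree m)) (+-inverseʳ (evalQ q (ℕtoℚ m))))

three-members⇒3≤∣W∣ : ∀ {m} {W : Subset m} {x y z} → x ∈ W → y ∈ W → z ∈ W → x ≢ y → x ≢ z → y ≢ z → 3 ℕ.≤ size W
three-members⇒3≤∣W∣ {W = W} {x} {y} {z} x∈W y∈W z∈W x≢y x≢z y≢z =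
  ℕP.≤-trans (s≤s (ℕP.≤-trans (s≤s (ℕP.≤-trans (s≤s z≤n) ∣W-x-y-z∣<∣W-x-y∣)) ∣W-x-y∣<∣W-x∣)) ∣W-x∣<∣W∣
  where
  ∣W-x∣<∣W∣ : size (W ∖ x) ℕ.< size W
  ∣W-x∣<∣W∣ = x∈p⇒∣p-x∣<∣p∣ x∈W
  ∣W-x-y∣<∣W-x∣ : size (W ∖ x ∖ y) ℕ.< size (W ∖ x)
  ∣W-x-y∣<∣W-x∣ = x∈p⇒∣p-x∣<∣p∣ (x∈p∧x≢y⇒x∈p-y y∈W (λ e → x≢y (sym e)))
  ∣W-x-y-z∣<∣W-x-y∣ : size (W ∖ x ∖ y ∖ z) ℕ.< size (W ∖ x ∖ y)
  ∣W-x-y-z∣<∣W-x-y∣ = x∈p⇒∣p-x∣<∣p∣ (x∈p∧x≢y⇒x∈p-y (x∈p∧x≢y⇒x∈p-y z∈W (λ e → x≢z (sym e))) (λ e → y≢z (sym e)))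

one-of-three-∉ : ∀ {m} (W : Subset m) → size W ℕ.< 3 → ∀ {x y z} → x ≢ y → x ≢ z → y ≢ z → x ∉ W ⊎ y ∉ W ⊎ z ∉ W
one-of-three-∉ W ∣W∣<3 {x} {y} {z} x≢y x≢z y≢z with x ∈? W | y ∈? W | z ∈? W
... | no x∉W | _ | _ = inj₁ x∉W
... | yes _ | no y∉W | _ = inj₂ (inj₁ y∉W)
... | yes _ | yes _ | no z∉W = inj₂ (inj₂ z∉W)
... | yes x∈W | yes y∈W | yes z∈W = ⊥-elim (ℕP.<⇒≱ ∣W∣<3 (three-members⇒3≤∣W∣ x∈W y∈W z∈W x≢y x≢z y≢z))

no-2-colouring-of-C₅ : ∀ (a b c d e : Bool) → a ≢ b → b ≢ c → c ≢ d → d ≢ e → e ≢ a → ⊥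
no-2-colouring-of-C₅ a b c d e a≢b b≢c c≢d d≢e e≢a = not-¬ refl a≡not-a
  where
  a≡not-a : a ≡ not a
  a≡not-a = begin
    a             ≡⟨ ¬-not (λ a≡e → e≢a (sym a≡e)) ⟩
    not e         ≡⟨ cong not (¬-not (λ e≡d → d≢e (sym e≡d))) ⟩
    not (not d)   ≡⟨ not-involutive d ⟩
    d             ≡⟨ ¬-not (λ d≡c → c≢d (sym d≡c)) ⟩
    not c         ≡⟨ cong not (¬-not (λ c≡b → b≢c (sym c≡b))) ⟩
    not (not b)   ≡⟨ not-involutive b ⟩
    b             ≡⟨ ¬-not (λ b≡a → a≢b (sym b≡a)) ⟩
    not a         ∎

module ReachWithout (G : Graph) (W : Subset (n G)) (adj-sym : ∀ i j → adj G i j ≡ true → adj G j i ≡ true) where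

  start∉W : ∀ {u v} → Reach G W u v → u ∉ W
  start∉W (here u∉W) = u∉W
  start∉W (step u∉W _ _) = u∉W

  reach-trans : ∀ {u v w} → Reach G W u v → Reach G W v w → Reach G W u w
  reach-trans (here _) r = r
  reach-trans (step u∉W u~w r) r′ = step u∉W u~w (reach-trans r r′)

  reach-edge : ∀ {u v} → u ∉ W → v ∉ W → adj G u v ≡ true → Reach G W u v
  reach-edge u∉W v∉W u~v = step u∉W u~v (here v∉W)

  reach-sym : ∀ {u v} → Reach G W u v → Reach G W v u
  reach-sym (here u∉W) = here u∉W
  reach-sym (step u∉W u~w r) = reach-trans (reach-sym r) (reach-edge (start∉W r) u∉W (adj-sym _ _ u~w))

module XStructure (s t : ℕ) where

  V : Set
  V = Fin (n (X s t))

  v₀ v₁ v₂ v₃ v₄ : V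
  v₀ = zero
  v₁ = suc zero
  v₂ = suc (suc zero)
  v₃ = suc (suc (suc zero))
  v₄ = suc (suc (suc (suc zero)))

  sv : Fin s → V
  sv m = suc (suc (suc (suc (suc (m ↑ˡ t)))))

  tv : Fin t → V
  tv m = suc (suc (suc (suc (suc (s ↑ʳ m)))))

  tv-injective : ∀ {m m′} → tv m ≡ tv m′ → m ≡ m′
  tv-injective e = ↑ʳ-injective s _ _ (suc-injective (suc-injective (suc-injective (suc-injective (suc-injective e)))))

  kind-sv : ∀ m → kind s t (sv m) ≡ InS
  kind-sv m rewrite splitAt-↑ˡ s m t = refl

  kind-tv : ∀ m → kind s t (tv m) ≡ InT
  kind-tv m rewrite splitAt-↑ʳ s t m = refl

  Located : V → Kind → Set
  Located i V0 = i ≡ v₀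
  Located i V1 = i ≡ v₁
  Located i V2 = i ≡ v₂
  Located i V3 = i ≡ v₃
  Located i V4 = i ≡ v₄
  Located i InS = Σ (Fin s) λ m → i ≡ sv m
  Located i InT = Σ (Fin t) λ m → i ≡ tv m

  located : ∀ i → Located i (kind s t i)
  located zero = refl
  located (suc zero) = refl
  located (suc (suc zero)) = refl
  located (suc (suc (suc zero))) = refl
  located (suc (suc (suc (suc zero)))) = refl
  located (suc (suc (suc (suc (suc j))))) = located-ST j (splitAt s j) refl
    where
    at : Fin (s ℕ.+ t) → V
    at j = suc (suc (suc (suc (suc j))))
    located-ST : ∀ j v → splitAt s j ≡ v → Located (at j) (kind s t (at j))
    located-ST j (inj₁ m) eq = subst (λ j → Located (at j) (kind s t (at j))) (splitAt⁻¹-↑ˡ eq)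
                                 (subst (Located (sv m)) (sym (kind-sv m)) (m , refl))
    located-ST j (inj₂ m) eq = subst (λ j → Located (at j) (kind s t (at j))) (splitAt⁻¹-↑ʳ eq)
                                 (subst (Located (tv m)) (sym (kind-tv m)) (m , refl))

  adj-sym : ∀ i j → adj (X s t) i j ≡ true → adj (X s t) j i ≡ true
  adj-sym i j = trans (∨-comm (edgeKind (kind s t j) (kind s t i)) (edgeKind (kind s t i) (kind s t j)))

  edge⇒adj : ∀ i j {K L} → kind s t i ≡ K → kind s t j ≡ L → edgeKind K L ≡ true → adj (X s t) i j ≡ true
  edge⇒adj i j refl refl e rewrite e = refl

  v₀~sv : ∀ m → adj (X s t) v₀ (sv m) ≡ true
  v₀~sv m = edge⇒adj v₀ (sv m) refl (kind-sv m) refl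
  v₁~sv : ∀ m → adj (X s t) v₁ (sv m) ≡ true
  v₁~sv m = edge⇒adj v₁ (sv m) refl (kind-sv m) refl
  v₃~sv : ∀ m → adj (X s t) v₃ (sv m) ≡ true
  v₃~sv m = edge⇒adj v₃ (sv m) refl (kind-sv m) refl
  v₀~tv : ∀ m → adj (X s t) v₀ (tv m) ≡ true
  v₀~tv m = edge⇒adj v₀ (tv m) refl (kind-tv m) refl
  v₂~tv : ∀ m → adj (X s t) v₂ (tv m) ≡ true
  v₂~tv m = edge⇒adj v₂ (tv m) refl (kind-tv m) refl
  v₄~tv : ∀ m → adj (X s t) v₄ (tv m) ≡ true
  v₄~tv m = edge⇒adj v₄ (tv m) refl (kind-tv m) refl

X-not-bipartite : ∀ s t → 1 ℕ.≤ s → 1 ℕ.≤ t → ¬ Bipartite (X s t)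
X-not-bipartite (suc s) (suc t) _ _ (colour , proper) = no-2-colouring-of-C₅
  (colour v₁) (colour (sv zero)) (colour v₀) (colour (tv zero)) (colour v₂)
  (proper v₁ (sv zero) (v₁~sv zero)) (proper (sv zero) v₀ (adj-sym v₀ (sv zero) (v₀~sv zero)))
  (proper v₀ (tv zero) (v₀~tv zero)) (proper (tv zero) v₂ (adj-sym v₂ (tv zero) (v₂~tv zero))) (proper v₂ v₁ refl)
  where open XStructure (suc s) (suc t)

-- Each S- or T-vertex has three neighbours among v₀,…,v₄, so one of them survives the deletion.
module RemovingFewerThanThree (s t : ℕ) (W : Subset (n (X (3 ℕ.+ s) (3 ℕ.+ t)))) (∣W∣<3 : size W ℕ.< 3) where
  open XStructure (3 ℕ.+ s) (3 ℕ.+ t)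
  open ReachWithout (X (3 ℕ.+ s) (3 ℕ.+ t)) W adj-sym

  Reach′ : V → V → Set
  Reach′ = Reach (X (3 ℕ.+ s) (3 ℕ.+ t)) W

  σ : Σ (Fin (3 ℕ.+ s)) λ m → sv m ∉ W
  σ with one-of-three-∉ W ∣W∣<3 {sv zero} {sv (suc zero)} {sv (suc (suc zero))} (λ ()) (λ ()) (λ ())
  ... | inj₁ ∉W = zero , ∉W
  ... | inj₂ (inj₁ ∉W) = suc zero , ∉W
  ... | inj₂ (inj₂ ∉W) = suc (suc zero) , ∉W

  τ : Σ (Fin (3 ℕ.+ t)) λ m → tv m ∉ W
  τ with one-of-three-∉ W ∣W∣<3 {tv zero} {tv (suc zero)} {tv (suc (suc zero))}
           (λ e → 0≢1 (tv-injective e)) (λ e → 0≢2 (tv-injective e)) (λ e → 1≢2 (tv-injective e))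
    where
    0≢1 : zero ≢ suc zero
    0≢1 ()
    0≢2 : zero ≢ suc (suc zero)
    0≢2 ()
    1≢2 : suc zero ≢ suc (suc zero)
    1≢2 ()
  ... | inj₁ ∉W = zero , ∉W
  ... | inj₂ (inj₁ ∉W) = suc zero , ∉W
  ... | inj₂ (inj₂ ∉W) = suc (suc zero) , ∉W

  mσ : Fin (3 ℕ.+ s)
  mσ = proj₁ σ
  σ∉W : sv mσ ∉ W
  σ∉W = proj₂ σ
  mτ : Fin (3 ℕ.+ t)
  mτ = proj₁ τ
  τ∉W : tv mτ ∉ W
  τ∉W = proj₂ τ

  three-deleted : ∀ {x y z} → x ∈ W → y ∈ W → z ∈ W → x ≢ y → x ≢ z → y ≢ z → ⊥
  three-deleted x∈W y∈W z∈W x≢y x≢z y≢z = ℕP.<⇒≱ ∣W∣<3 (three-members⇒3≤∣W∣ x∈W y∈W z∈W x≢y x≢z y≢z)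

  τ-to-σ : Reach′ (tv mτ) (sv mσ)
  τ-to-σ with v₀ ∈? W | v₁ ∈? W | v₂ ∈? W | v₃ ∈? W | v₄ ∈? W
  ... | no v₀∉W | _ | _ | _ | _ =
    step τ∉W (adj-sym v₀ (tv mτ) (v₀~tv mτ)) (reach-edge v₀∉W σ∉W (v₀~sv mσ))
  ... | yes _ | no v₁∉W | no v₂∉W | _ | _ =
    step τ∉W (adj-sym v₂ (tv mτ) (v₂~tv mτ)) (step v₂∉W refl (reach-edge v₁∉W σ∉W (v₁~sv mσ)))
  ... | yes _ | _ | _ | no v₃∉W | no v₄∉W =
    step τ∉W (adj-sym v₄ (tv mτ) (v₄~tv mτ)) (step v₄∉W refl (reach-edge v₃∉W σ∉W (v₃~sv mσ)))
  ... | yes v₀∈W | yes v₁∈W | _ | yes v₃∈W | _ = ⊥-elim (three-deleted v₀∈W v₁∈W v₃∈W (λ ()) (λ ()) (λ ()))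
  ... | yes v₀∈W | yes v₁∈W | _ | no _ | yes v₄∈W = ⊥-elim (three-deleted v₀∈W v₁∈W v₄∈W (λ ()) (λ ()) (λ ()))
  ... | yes v₀∈W | no _ | yes v₂∈W | yes v₃∈W | _ = ⊥-elim (three-deleted v₀∈W v₂∈W v₃∈W (λ ()) (λ ()) (λ ()))
  ... | yes v₀∈W | no _ | yes v₂∈W | no _ | yes v₄∈W = ⊥-elim (three-deleted v₀∈W v₂∈W v₄∈W (λ ()) (λ ()) (λ ()))

  to-σ : ∀ u → u ∉ W → Reach′ u (sv mσ)
  to-σ u = by-kind u (kind (3 ℕ.+ s) (3 ℕ.+ t) u) (located u)
    where
    by-kind : ∀ u K → Located u K → u ∉ W → Reach′ u (sv mσ)
    by-kind _ V0 refl v₀∉W = reach-edge v₀∉W σ∉W (v₀~sv mσ)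
    by-kind _ V1 refl v₁∉W = reach-edge v₁∉W σ∉W (v₁~sv mσ)
    by-kind _ V3 refl v₃∉W = reach-edge v₃∉W σ∉W (v₃~sv mσ)
    by-kind _ V2 refl v₂∉W = step v₂∉W (v₂~tv mτ) τ-to-σ
    by-kind _ V4 refl v₄∉W = step v₄∉W (v₄~tv mτ) τ-to-σ
    by-kind _ InS (m , refl) u∉W with one-of-three-∉ W ∣W∣<3 {v₀} {v₁} {v₃} (λ ()) (λ ()) (λ ())
    ... | inj₁ v₀∉W = step u∉W (adj-sym v₀ (sv m) (v₀~sv m)) (reach-edge v₀∉W σ∉W (v₀~sv mσ))
    ... | inj₂ (inj₁ v₁∉W) = step u∉W (adj-sym v₁ (sv m) (v₁~sv m)) (reach-edge v₁∉W σ∉W (v₁~sv mσ))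
    ... | inj₂ (inj₂ v₃∉W) = step u∉W (adj-sym v₃ (sv m) (v₃~sv m)) (reach-edge v₃∉W σ∉W (v₃~sv mσ))
    by-kind _ InT (m , refl) u∉W with one-of-three-∉ W ∣W∣<3 {v₀} {v₂} {v₄} (λ ()) (λ ()) (λ ())
    ... | inj₁ v₀∉W = step u∉W (adj-sym v₀ (tv m) (v₀~tv m)) (step v₀∉W (v₀~tv mτ) τ-to-σ)
    ... | inj₂ (inj₁ v₂∉W) = step u∉W (adj-sym v₂ (tv m) (v₂~tv m)) (step v₂∉W (v₂~tv mτ) τ-to-σ)
    ... | inj₂ (inj₂ v₄∉W) = step u∉W (adj-sym v₄ (tv m) (v₄~tv m)) (step v₄∉W (v₄~tv mτ) τ-to-σ)

  connected : ConnectedWithout (X (3 ℕ.+ s) (3 ℕ.+ t)) W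
  connected u v u∉W v∉W = reach-trans (to-σ u u∉W) (reach-sym (to-σ v v∉W))

X-3-connected : ∀ s t → 3 ℕ.≤ s → 3 ℕ.≤ t → KConnected 3 (X s t)
X-3-connected (suc (suc (suc s))) (suc (suc (suc t))) (s≤s (s≤s (s≤s _))) (s≤s (s≤s (s≤s _))) =
  s≤s (s≤s (s≤s (s≤s z≤n))) , λ W ∣W∣<3 → RemovingFewerThanThree.connected s t W ∣W∣<3

count : ∀ {A : Set} → (A → Bool) → List A → ℕ
count p [] = 0
count p (x ∷ xs) = (if p x then 1 else 0) ℕ.+ count p xs

length-filterᵇ : ∀ {A : Set} (p : A → Bool) xs → length (filterᵇ p xs) ≡ count p xs
length-filterᵇ p [] = refl
length-filterᵇ p (x ∷ xs) with p x
... | true = cong suc (length-filterᵇ p xs)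
... | false = length-filterᵇ p xs

count-++ : ∀ {A : Set} (p : A → Bool) xs ys → count p (xs ++ ys) ≡ count p xs ℕ.+ count p ys
count-++ p [] ys = refl
count-++ p (x ∷ xs) ys = trans (cong ((if p x then 1 else 0) ℕ.+_) (count-++ p xs ys)) (sym (ℕP.+-assoc (if p x then 1 else 0) _ _))

count-map : ∀ {A B : Set} (p : B → Bool) (f : A → B) xs → count p (map f xs) ≡ count (λ x → p (f x)) xs
count-map p f [] = refl
count-map p f (x ∷ xs) = cong ((if p (f x) then 1 else 0) ℕ.+_) (count-map p f xs)

count-cong : ∀ {A : Set} {p q : A → Bool} xs → (∀ x → p x ≡ q x) → count p xs ≡ count q xs
count-cong [] p≗q = refl
count-cong (x ∷ xs) p≗q = cong₂ (λ b n → (if b then 1 else 0) ℕ.+ n) (p≗q x) (count-cong xs p≗q)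

count-∧ : ∀ {A : Set} b (q : A → Bool) xs → ℕtoℚ (count (λ x → b ∧ q x) xs) ≡ 𝟙 b * ℕtoℚ (count q xs)
count-∧ true q xs = sym (*-identityˡ _)
count-∧ false q xs = trans (cong ℕtoℚ (count-false xs)) (sym (*-zeroˡ (ℕtoℚ (count q xs))))
  where
  count-false : ∀ xs → count (λ x → false ∧ q x) xs ≡ 0
  count-false [] = refl
  count-false (x ∷ xs) = count-false xs

count-allVecs-suc : ∀ {k} m (p : Vec (Fin k) (suc m) → Bool) →
  ℕtoℚ (count p (allVecs (suc m) k)) ≡ ∑[ c < k ] ℕtoℚ (count (λ v → p (c ∷ v)) (allVecs m k))
count-allVecs-suc {k} m p = go k (λ c → c)
  where
  go : ∀ j (f : Fin j → Fin k) → ℕtoℚ (count p (concatMap (λ c → map (c ∷_) (allVecs m k)) (tabulate f)))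
                                 ≡ ∑[ c < j ] ℕtoℚ (count (λ v → p (f c ∷ v)) (allVecs m k))
  go zero f = refl
  go (suc j) f = begin
    ℕtoℚ (count p (map (f zero ∷_) (allVecs m k) ++ rest))                  ≡⟨ cong ℕtoℚ (count-++ p (map (f zero ∷_) (allVecs m k)) rest) ⟩
    ℕtoℚ (count p (map (f zero ∷_) (allVecs m k)) ℕ.+ count p rest)         ≡⟨ ℕtoℚ-+ (count p (map (f zero ∷_) (allVecs m k))) (count p rest) ⟩
    ℕtoℚ (count p (map (f zero ∷_) (allVecs m k))) + ℕtoℚ (count p rest)    ≡⟨ cong₂ _+_ (cong ℕtoℚ (count-map p (f zero ∷_) (allVecs m k))) (go j (λ c → f (suc c))) ⟩
    _ ∎
    where
    rest : List (Vec (Fin k) (suc m))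
    rest = concatMap (λ c → map (c ∷_) (allVecs m k)) (tabulate (λ c → f (suc c)))

module Blockwise {k : ℕ} (pS pT : Fin k → Bool) where

  allᵛ : ∀ {m} → Vec (Fin k) m → Bool
  allᵛ [] = true
  allᵛ (x ∷ r) = pT x ∧ allᵛ r

  blockwise : ∀ s {t} → Vec (Fin k) (s ℕ.+ t) → Bool
  blockwise zero r = allᵛ r
  blockwise (suc s) (x ∷ r) = pS x ∧ blockwise s r

  allᵛ⇒ : ∀ {m} (r : Vec (Fin k) m) → allᵛ r ≡ true → ∀ i → pT (lookup r i) ≡ true
  allᵛ⇒ (x ∷ r) e i with pT x in ex
  allᵛ⇒ (x ∷ r) e zero | true = ex
  allᵛ⇒ (x ∷ r) e (suc i) | true = allᵛ⇒ r e i

  allᵛ⇐ : ∀ {m} (r : Vec (Fin k) m) → (∀ i → pT (lookup r i) ≡ true) → allᵛ r ≡ true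
  allᵛ⇐ [] _ = refl
  allᵛ⇐ (x ∷ r) h rewrite h zero = allᵛ⇐ r (λ i → h (suc i))

  blockwise⇒S : ∀ s {t} (r : Vec (Fin k) (s ℕ.+ t)) → blockwise s r ≡ true → ∀ m → pS (lookup r (m ↑ˡ t)) ≡ true
  blockwise⇒S (suc s) (x ∷ r) e m with pS x in ex
  blockwise⇒S (suc s) (x ∷ r) e zero | true = ex
  blockwise⇒S (suc s) (x ∷ r) e (suc m) | true = blockwise⇒S s r e m

  blockwise⇒T : ∀ s {t} (r : Vec (Fin k) (s ℕ.+ t)) → blockwise s r ≡ true → ∀ m → pT (lookup r (s ↑ʳ m)) ≡ true
  blockwise⇒T zero r e m = allᵛ⇒ r e m
  blockwise⇒T (suc s) (x ∷ r) e m with pS x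
  ... | true = blockwise⇒T s r e m

  blockwise⇐ : ∀ s {t} (r : Vec (Fin k) (s ℕ.+ t)) → (∀ m → pS (lookup r (m ↑ˡ t)) ≡ true) →
               (∀ m → pT (lookup r (s ↑ʳ m)) ≡ true) → blockwise s r ≡ true
  blockwise⇐ zero r _ hT = allᵛ⇐ r hT
  blockwise⇐ (suc s) (x ∷ r) hS hT rewrite hS zero = blockwise⇐ s r (λ m → hS (suc m)) hT

  #S #T : ℚ
  #S = ∑[ c < k ] 𝟙 (pS c)
  #T = ∑[ c < k ] 𝟙 (pT c)

  count-allᵛ : ∀ t → ℕtoℚ (count allᵛ (allVecs t k)) ≡ #T ^ t
  count-allᵛ zero = refl
  count-allᵛ (suc t) = begin
    ℕtoℚ (count allᵛ (allVecs (suc t) k))                           ≡⟨ count-allVecs-suc t allᵛ ⟩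
    ∑[ c < k ] ℕtoℚ (count (λ v → pT c ∧ allᵛ v) (allVecs t k))     ≡⟨ sum-cong-≗ (λ c → count-∧ (pT c) allᵛ (allVecs t k)) ⟩
    ∑[ c < k ] (𝟙 (pT c) * ℕtoℚ (count allᵛ (allVecs t k)))         ≡⟨ *-distribʳ-sum _ (λ c → 𝟙 (pT c)) ⟨
    #T * ℕtoℚ (count allᵛ (allVecs t k))                             ≡⟨ cong (#T *_) (count-allᵛ t) ⟩
    #T ^ suc t                                                       ∎

  count-blockwise : ∀ s t → ℕtoℚ (count (blockwise s {t}) (allVecs (s ℕ.+ t) k)) ≡ #S ^ s * #T ^ t
  count-blockwise zero t = trans (count-allᵛ t) (sym (*-identityˡ _))
  count-blockwise (suc s) t = begin
    ℕtoℚ (count (blockwise (suc s)) (allVecs (suc (s ℕ.+ t)) k))                 ≡⟨ count-allVecs-suc (s ℕ.+ t) (blockwise (suc s)) ⟩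
    ∑[ c < k ] ℕtoℚ (count (λ v → pS c ∧ blockwise s v) (allVecs (s ℕ.+ t) k))   ≡⟨ sum-cong-≗ (λ c → count-∧ (pS c) (blockwise s) (allVecs (s ℕ.+ t) k)) ⟩
    ∑[ c < k ] (𝟙 (pS c) * ℕtoℚ (count (blockwise s) (allVecs (s ℕ.+ t) k)))     ≡⟨ *-distribʳ-sum _ (λ c → 𝟙 (pS c)) ⟨
    #S * ℕtoℚ (count (blockwise s) (allVecs (s ℕ.+ t) k))                         ≡⟨ cong (#S *_) (count-blockwise s t) ⟩
    #S * (#S ^ s * #T ^ t)                                                        ≡⟨ *-assoc #S _ _ ⟨
    #S ^ suc s * #T ^ t                                                           ∎

Proper : (G : Graph) {k : ℕ} → Vec (Fin k) (n G) → Set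
Proper G c = ∀ i j → adj G i j ≡ true → lookup c i ≢ lookup c j

and⇒All : ∀ bs → and bs ≡ true → All (_≡ true) bs
and⇒All [] _ = []
and⇒All (true ∷ bs) e = refl ∷ and⇒All bs e

All⇒and : ∀ bs → All (_≡ true) bs → and bs ≡ true
All⇒and [] [] = refl
All⇒and (b ∷ bs) (refl ∷ all) = All⇒and bs all

properB⇒Proper : (G : Graph) {k : ℕ} (c : Vec (Fin k) (n G)) → properB G c ≡ true → Proper G c
properB⇒Proper G c e i j i~j ci≡cj = respected (All.tabulate⁻ (All.map⁻ (All.tabulate⁻ (All.map⁻ (All.concat⁻ (and⇒All _ e))) i)) j)
  where
  respected : not (adj G i j ∧ ⌊ lookup c i Fin.≟ lookup c j ⌋) ≡ true → ⊥
  respected h rewrite i~j with lookup c i Fin.≟ lookup c j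
  respected () | yes _
  ... | no ci≢cj = ci≢cj ci≡cj

Proper⇒properB : (G : Graph) {k : ℕ} (c : Vec (Fin k) (n G)) → Proper G c → properB G c ≡ true
Proper⇒properB G c proper = All⇒and _ (All.concat⁺ (All.map⁺ (All.tabulate⁺ (λ i → All.map⁺ (All.tabulate⁺ (λ j → respected i j))))))
  where
  respected : ∀ i j → not (adj G i j ∧ ⌊ lookup c i Fin.≟ lookup c j ⌋) ≡ true
  respected i j with adj G i j in i~j | lookup c i Fin.≟ lookup c j
  ... | true | yes ci≡cj = ⊥-elim (proper i j i~j ci≡cj)
  ... | true | no _ = refl
  ... | false | _ = refl

∧-true⇒ˡ : ∀ {a b} → a ∧ b ≡ true → a ≡ true
∧-true⇒ˡ {true} _ = refl

∧-true⇒ʳ : ∀ {a b} → a ∧ b ≡ true → b ≡ true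
∧-true⇒ʳ {true} e = e

∨-true⇒ : ∀ {a b} → a ∨ b ≡ true → a ≡ true ⊎ b ≡ true
∨-true⇒ {true} _ = inj₁ refl
∨-true⇒ {false} e = inj₂ e

avoids : ∀ {k} → Fin k → Fin k → Fin k → Fin k → Bool
avoids a b d x = x ≠ᵇ a ∧ (x ≠ᵇ b ∧ x ≠ᵇ d)

avoids-≢₁ : ∀ {k} {a b d x : Fin k} → avoids a b d x ≡ true → x ≢ a
avoids-≢₁ e = ≠ᵇ⇒≢ (∧-true⇒ˡ e)

avoids-≢₂ : ∀ {k} {a b d x : Fin k} → avoids a b d x ≡ true → x ≢ b
avoids-≢₂ {a = a} {x = x} e = ≠ᵇ⇒≢ (∧-true⇒ˡ (∧-true⇒ʳ {x ≠ᵇ a} e))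

avoids-≢₃ : ∀ {k} {a b d x : Fin k} → avoids a b d x ≡ true → x ≢ d
avoids-≢₃ {a = a} {b} {x = x} e = ≠ᵇ⇒≢ (∧-true⇒ʳ {x ≠ᵇ b} (∧-true⇒ʳ {x ≠ᵇ a} e))

≢⇒avoids : ∀ {k} {a b d x : Fin k} → x ≢ a → x ≢ b → x ≢ d → avoids a b d x ≡ true
≢⇒avoids x≢a x≢b x≢d rewrite ≢⇒≠ᵇ x≢a | ≢⇒≠ᵇ x≢b | ≢⇒≠ᵇ x≢d = refl

module ColouringsOfX (s t : ℕ) {k : ℕ} (c₀ c₁ c₂ c₃ c₄ : Fin k) where
  open XStructure s t
  open Blockwise (avoids c₀ c₁ c₃) (avoids c₀ c₂ c₄) public

  colouring : Vec (Fin k) (s ℕ.+ t) → Vec (Fin k) (n (X s t))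
  colouring r = c₀ ∷ c₁ ∷ c₂ ∷ c₃ ∷ c₄ ∷ r

  admissible : Vec (Fin k) (s ℕ.+ t) → Bool
  admissible r = (c₂ ≠ᵇ c₁ ∧ c₄ ≠ᵇ c₃) ∧ blockwise s r

  Proper⇒admissible : ∀ r → Proper (X s t) (colouring r) → admissible r ≡ true
  Proper⇒admissible r proper with c₂ Fin.≟ c₁ | c₄ Fin.≟ c₃
  ... | yes c₂≡c₁ | _ = ⊥-elim (proper v₁ v₂ refl (sym c₂≡c₁))
  ... | no _ | yes c₄≡c₃ = ⊥-elim (proper v₃ v₄ refl (sym c₄≡c₃))
  ... | no _ | no _ = blockwise⇐ s r
    (λ m → ≢⇒avoids (proper (sv m) v₀ (adj-sym v₀ (sv m) (v₀~sv m))) (proper (sv m) v₁ (adj-sym v₁ (sv m) (v₁~sv m)))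
                    (proper (sv m) v₃ (adj-sym v₃ (sv m) (v₃~sv m))))
    (λ m → ≢⇒avoids (proper (tv m) v₀ (adj-sym v₀ (tv m) (v₀~tv m))) (proper (tv m) v₂ (adj-sym v₂ (tv m) (v₂~tv m)))
                    (proper (tv m) v₄ (adj-sym v₄ (tv m) (v₄~tv m))))

  module _ (r : Vec (Fin k) (s ℕ.+ t)) (e : admissible r ≡ true) where
    private
      c₂≢c₁ : c₂ ≢ c₁
      c₂≢c₁ = ≠ᵇ⇒≢ (∧-true⇒ˡ (∧-true⇒ˡ e))
      c₄≢c₃ : c₄ ≢ c₃
      c₄≢c₃ = ≠ᵇ⇒≢ (∧-true⇒ʳ {c₂ ≠ᵇ c₁} (∧-true⇒ˡ e))
      S-avoids : ∀ m → avoids c₀ c₁ c₃ (lookup r (m ↑ˡ t)) ≡ true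
      S-avoids = blockwise⇒S s r (∧-true⇒ʳ {c₂ ≠ᵇ c₁ ∧ c₄ ≠ᵇ c₃} e)
      T-avoids : ∀ m → avoids c₀ c₂ c₄ (lookup r (s ↑ʳ m)) ≡ true
      T-avoids = blockwise⇒T s r (∧-true⇒ʳ {c₂ ≠ᵇ c₁ ∧ c₄ ≠ᵇ c₃} e)
      along-edge : ∀ i j K L → Located i K → Located j L → edgeKind K L ≡ true → lookup (colouring r) i ≢ lookup (colouring r) j
      along-edge _ _ V0 InS refl (m , refl) _ = λ same → avoids-≢₁ (S-avoids m) (sym same)
      along-edge _ _ V0 InT refl (m , refl) _ = λ same → avoids-≢₁ (T-avoids m) (sym same)
      along-edge _ _ V1 V2 refl refl _ = λ same → c₂≢c₁ (sym same)
      along-edge _ _ V1 InS refl (m , refl) _ = λ same → avoids-≢₂ (S-avoids m) (sym same)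
      along-edge _ _ V2 InT refl (m , refl) _ = λ same → avoids-≢₂ (T-avoids m) (sym same)
      along-edge _ _ V3 V4 refl refl _ = λ same → c₄≢c₃ (sym same)
      along-edge _ _ V3 InS refl (m , refl) _ = λ same → avoids-≢₃ (S-avoids m) (sym same)
      along-edge _ _ V4 InT refl (m , refl) _ = λ same → avoids-≢₃ (T-avoids m) (sym same)
      along-edge _ _ InS _ _ _ ()
      along-edge _ _ InT _ _ _ ()
      along-edge _ _ V0 V0 _ _ ()
      along-edge _ _ V0 V1 _ _ ()
      along-edge _ _ V0 V2 _ _ ()
      along-edge _ _ V0 V3 _ _ ()
      along-edge _ _ V0 V4 _ _ ()
      along-edge _ _ V1 V0 _ _ ()
      along-edge _ _ V1 V1 _ _ ()
      along-edge _ _ V1 V3 _ _ ()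
      along-edge _ _ V1 V4 _ _ ()
      along-edge _ _ V1 InT _ _ ()
      along-edge _ _ V2 V0 _ _ ()
      along-edge _ _ V2 V1 _ _ ()
      along-edge _ _ V2 V2 _ _ ()
      along-edge _ _ V2 V3 _ _ ()
      along-edge _ _ V2 V4 _ _ ()
      along-edge _ _ V2 InS _ _ ()
      along-edge _ _ V3 V0 _ _ ()
      along-edge _ _ V3 V1 _ _ ()
      along-edge _ _ V3 V2 _ _ ()
      along-edge _ _ V3 V3 _ _ ()
      along-edge _ _ V3 InT _ _ ()
      along-edge _ _ V4 V0 _ _ ()
      along-edge _ _ V4 V1 _ _ ()
      along-edge _ _ V4 V2 _ _ ()
      along-edge _ _ V4 V3 _ _ ()
      along-edge _ _ V4 V4 _ _ ()
      along-edge _ _ V4 InS _ _ ()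

    admissible⇒Proper : Proper (X s t) (colouring r)
    admissible⇒Proper i j i~j with ∨-true⇒ i~j
    ... | inj₁ ij = along-edge i j _ _ (located i) (located j) ij
    ... | inj₂ ji = λ same → along-edge j i _ _ (located j) (located i) ji (sym same)

avoiding : ∀ {k} → Fin k → Fin k → Fin k → ℚ
avoiding {k} a b d = ∑[ x < k ] 𝟙 (avoids a b d x)

true-iff⇒≡ : ∀ {a b : Bool} → (a ≡ true → b ≡ true) → (b ≡ true → a ≡ true) → a ≡ b
true-iff⇒≡ {true} a⇒b _ = sym (a⇒b refl)
true-iff⇒≡ {false} {true} _ b⇒a = b⇒a refl
true-iff⇒≡ {false} {false} _ _ = refl

colourings-of-X : ∀ s t k → ℕtoℚ (numColourings (X s t) k) ≡
  ∑[ c₀ < k ] ∑[ c₁ < k ] ∑[ c₂ < k ] ∑[ c₃ < k ] ∑[ c₄ < k ]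
    (𝟙 (c₂ ≠ᵇ c₁ ∧ c₄ ≠ᵇ c₃) * (avoiding c₀ c₁ c₃ ^ s * avoiding c₀ c₂ c₄ ^ t))
colourings-of-X s t k = begin
  ℕtoℚ (length (filterᵇ (properB (X s t)) (allVecs (5 ℕ.+ (s ℕ.+ t)) k)))
    ≡⟨ cong ℕtoℚ (length-filterᵇ (properB (X s t)) (allVecs (5 ℕ.+ (s ℕ.+ t)) k)) ⟩
  ℕtoℚ (count (properB (X s t)) (allVecs (5 ℕ.+ (s ℕ.+ t)) k))
    ≡⟨ count-allVecs-suc {k} (4 ℕ.+ (s ℕ.+ t)) (properB (X s t)) ⟩
  ∑[ c₀ < k ] ℕtoℚ (count (λ v → properB (X s t) (c₀ ∷ v)) (allVecs (4 ℕ.+ (s ℕ.+ t)) k))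
    ≡⟨ sum-cong-≗ (λ c₀ → trans (count-allVecs-suc {k} (3 ℕ.+ (s ℕ.+ t)) (λ v → properB (X s t) (c₀ ∷ v)))
       (sum-cong-≗ λ c₁ → trans (count-allVecs-suc {k} (2 ℕ.+ (s ℕ.+ t)) (λ v → properB (X s t) (c₀ ∷ c₁ ∷ v)))
       (sum-cong-≗ λ c₂ → trans (count-allVecs-suc {k} (1 ℕ.+ (s ℕ.+ t)) (λ v → properB (X s t) (c₀ ∷ c₁ ∷ c₂ ∷ v)))
       (sum-cong-≗ λ c₃ → trans (count-allVecs-suc {k} (s ℕ.+ t) (λ v → properB (X s t) (c₀ ∷ c₁ ∷ c₂ ∷ c₃ ∷ v)))
       (sum-cong-≗ λ c₄ → given-v₀…v₄ c₀ c₁ c₂ c₃ c₄))))) ⟩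
  _ ∎
  where
  given-v₀…v₄ : ∀ c₀ c₁ c₂ c₃ c₄ →
    ℕtoℚ (count (λ r → properB (X s t) (c₀ ∷ c₁ ∷ c₂ ∷ c₃ ∷ c₄ ∷ r)) (allVecs (s ℕ.+ t) k))
      ≡ 𝟙 (c₂ ≠ᵇ c₁ ∧ c₄ ≠ᵇ c₃) * (avoiding c₀ c₁ c₃ ^ s * avoiding c₀ c₂ c₄ ^ t)
  given-v₀…v₄ c₀ c₁ c₂ c₃ c₄ = begin
    ℕtoℚ (count (λ r → properB (X s t) (colouring r)) (allVecs (s ℕ.+ t) k))
      ≡⟨ cong ℕtoℚ (count-cong (allVecs (s ℕ.+ t) k) λ r →
           true-iff⇒≡ (λ e → Proper⇒admissible r (properB⇒Proper (X s t) (colouring r) e))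
                    (λ e → Proper⇒properB (X s t) (colouring r) (admissible⇒Proper r e))) ⟩
    ℕtoℚ (count admissible (allVecs (s ℕ.+ t) k))
      ≡⟨ count-∧ (c₂ ≠ᵇ c₁ ∧ c₄ ≠ᵇ c₃) (blockwise s) (allVecs (s ℕ.+ t) k) ⟩
    𝟙 (c₂ ≠ᵇ c₁ ∧ c₄ ≠ᵇ c₃) * ℕtoℚ (count (blockwise s) (allVecs (s ℕ.+ t) k))
      ≡⟨ cong (𝟙 (c₂ ≠ᵇ c₁ ∧ c₄ ≠ᵇ c₃) *_) (count-blockwise s t) ⟩
    𝟙 (c₂ ≠ᵇ c₁ ∧ c₄ ≠ᵇ c₃) * (avoiding c₀ c₁ c₃ ^ s * avoiding c₀ c₂ c₄ ^ t) ∎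
    where open ColouringsOfX s t c₀ c₁ c₂ c₃ c₄

module _ {k : ℕ} where

  avoids-self₁ : ∀ (a b d : Fin k) → avoids a b d a ≡ false
  avoids-self₁ a b d = cong (_∧ ((a ≠ᵇ b) ∧ (a ≠ᵇ d))) (≠ᵇ-refl a)

  avoids-self₂ : ∀ (a b d : Fin k) → avoids a b d b ≡ false
  avoids-self₂ a b d = trans (cong (λ z → (b ≠ᵇ a) ∧ (z ∧ (b ≠ᵇ d))) (≠ᵇ-refl b)) (∧-zeroʳ (b ≠ᵇ a))

  avoids-self₃ : ∀ (a b d : Fin k) → avoids a b d d ≡ false
  avoids-self₃ a b d = trans (cong (λ z → (d ≠ᵇ a) ∧ ((d ≠ᵇ b) ∧ z)) (≠ᵇ-refl d))
    (trans (cong ((d ≠ᵇ a) ∧_) (∧-zeroʳ (d ≠ᵇ b))) (∧-zeroʳ (d ≠ᵇ a)))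

  avoiding-swap : ∀ (a b d : Fin k) → avoiding a b d ≡ avoiding a d b
  avoiding-swap a b d = sum-cong-≗ λ x → cong (λ z → 𝟙 ((x ≠ᵇ a) ∧ z)) (∧-comm (x ≠ᵇ b) (x ≠ᵇ d))

  avoiding-one : ∀ (a : Fin k) → avoiding a a a ≡ ℕtoℚ k - 1ℚ
  avoiding-one a = begin
    avoiding a a a                                ≡⟨ ∑-constant-off₁ a _ (λ x x≢a → cong 𝟙 (≢⇒avoids x≢a x≢a x≢a)) ⟩
    𝟙 (avoids a a a a) + (ℕtoℚ k - 1ℚ) * 1ℚ       ≡⟨ cong (λ z → 𝟙 z + (ℕtoℚ k - 1ℚ) * 1ℚ) (avoids-self₁ a a a) ⟩
    0ℚ + (ℕtoℚ k - 1ℚ) * 1ℚ                       ≡⟨ solve 1 (λ u → con 0ℚ :+ u :* con 1ℚ := u) refl (ℕtoℚ k - 1ℚ) ⟩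
    ℕtoℚ k - 1ℚ                                   ∎

  avoiding-two : ∀ {a b d p q : Fin k} → p ≢ q → avoids a b d p ≡ false → avoids a b d q ≡ false →
                 (∀ x → x ≢ p → x ≢ q → avoids a b d x ≡ true) → avoiding a b d ≡ ℕtoℚ k - ℕtoℚ 2
  avoiding-two {a} {b} {d} {p} {q} p≢q p-taken q-taken others-free = begin
    avoiding a b d                                              ≡⟨ ∑-constant-off₂ p q _ p≢q (λ x x≢p x≢q → cong 𝟙 (others-free x x≢p x≢q)) ⟩
    𝟙 (avoids a b d p) + 𝟙 (avoids a b d q) + (ℕtoℚ k - ℕtoℚ 2) * 1ℚ ≡⟨ cong₂ (λ u v → 𝟙 u + 𝟙 v + (ℕtoℚ k - ℕtoℚ 2) * 1ℚ) p-taken q-taken ⟩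
    0ℚ + 0ℚ + (ℕtoℚ k - ℕtoℚ 2) * 1ℚ                             ≡⟨ solve 1 (λ u → con 0ℚ :+ con 0ℚ :+ u :* con 1ℚ := u) refl (ℕtoℚ k - ℕtoℚ 2) ⟩
    ℕtoℚ k - ℕtoℚ 2                                              ∎

  avoiding-aab : ∀ {a d : Fin k} → a ≢ d → avoiding a a d ≡ ℕtoℚ k - ℕtoℚ 2
  avoiding-aab {a} {d} a≢d = avoiding-two a≢d (avoids-self₁ a a d) (avoids-self₃ a a d) (λ x x≢a x≢d → ≢⇒avoids x≢a x≢a x≢d)

  avoiding-aba : ∀ {a b : Fin k} → a ≢ b → avoiding a b a ≡ ℕtoℚ k - ℕtoℚ 2
  avoiding-aba {a} {b} a≢b = avoiding-two a≢b (avoids-self₁ a b a) (avoids-self₂ a b a) (λ x x≢a x≢b → ≢⇒avoids x≢a x≢b x≢a)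

  avoiding-abb : ∀ {a b : Fin k} → a ≢ b → avoiding a b b ≡ ℕtoℚ k - ℕtoℚ 2
  avoiding-abb {a} {b} a≢b = avoiding-two a≢b (avoids-self₁ a b b) (avoids-self₂ a b b) (λ x x≢a x≢b → ≢⇒avoids x≢a x≢b x≢b)

  avoiding-three : ∀ {a b d : Fin k} → a ≢ b → a ≢ d → b ≢ d → avoiding a b d ≡ ℕtoℚ k - ℕtoℚ 3
  avoiding-three {a} {b} {d} a≢b a≢d b≢d = begin
    avoiding a b d
      ≡⟨ ∑-constant-off₃ a b d _ a≢b a≢d b≢d (λ x x≢a x≢b x≢d → cong 𝟙 (≢⇒avoids x≢a x≢b x≢d)) ⟩
    𝟙 (avoids a b d a) + 𝟙 (avoids a b d b) + 𝟙 (avoids a b d d) + (ℕtoℚ k - ℕtoℚ 3) * 1ℚ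
      ≡⟨ cong₂ (λ u v → u + 𝟙 v + (ℕtoℚ k - ℕtoℚ 3) * 1ℚ)
           (cong₂ (λ u v → 𝟙 u + 𝟙 v) (avoids-self₁ a b d) (avoids-self₂ a b d)) (avoids-self₃ a b d) ⟩
    0ℚ + 0ℚ + 0ℚ + (ℕtoℚ k - ℕtoℚ 3) * 1ℚ
      ≡⟨ solve 1 (λ u → con 0ℚ :+ con 0ℚ :+ con 0ℚ :+ u :* con 1ℚ := u) refl (ℕtoℚ k - ℕtoℚ 3) ⟩
    ℕtoℚ k - ℕtoℚ 3 ∎

-- Every sum over a colour is evaluated by splitting off the (at most three) colours already in
-- use, after which the summand is constant.
module ClosedForm (k s t : ℕ) where

  K u₁ u₂ u₃ : ℚ
  K = ℕtoℚ k
  u₁ = K - 1ℚ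
  u₂ = K - ℕtoℚ 2
  u₃ = K - ℕtoℚ 3

  row : Fin k → Fin k → ℚ
  row c₀ y = ∑[ z < k ] (avoiding c₀ y z ^ t)

  row₌ row≠ total : ℚ
  row₌ = u₁ ^ t + u₁ * u₂ ^ t
  row≠ = u₂ ^ t + u₂ ^ t + u₂ * u₃ ^ t
  total = row₌ + u₁ * row≠

  row-self : ∀ c₀ → row c₀ c₀ ≡ row₌
  row-self c₀ = begin
    row c₀ c₀                                ≡⟨ ∑-constant-off₁ c₀ _ (λ z z≢c₀ → cong (_^ t) (avoiding-aab (λ e → z≢c₀ (sym e)))) ⟩
    avoiding c₀ c₀ c₀ ^ t + u₁ * u₂ ^ t      ≡⟨ cong (λ a → a ^ t + u₁ * u₂ ^ t) (avoiding-one c₀) ⟩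
    row₌                                     ∎

  row-other : ∀ {c₀ y} → y ≢ c₀ → row c₀ y ≡ row≠
  row-other {c₀} {y} y≢c₀ = begin
    row c₀ y
      ≡⟨ ∑-constant-off₂ c₀ y _ c₀≢y (λ z z≢c₀ z≢y → cong (_^ t) (avoiding-three c₀≢y (λ e → z≢c₀ (sym e)) (λ e → z≢y (sym e)))) ⟩
    avoiding c₀ y c₀ ^ t + avoiding c₀ y y ^ t + u₂ * u₃ ^ t
      ≡⟨ cong₂ (λ a b → a ^ t + b ^ t + u₂ * u₃ ^ t) (avoiding-aba c₀≢y) (avoiding-abb c₀≢y) ⟩
    row≠ ∎
    where
    c₀≢y : c₀ ≢ y
    c₀≢y e = y≢c₀ (sym e)

  column : ∀ c₀ z → ∑[ y < k ] (avoiding c₀ y z ^ t) ≡ row c₀ z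
  column c₀ z = sum-cong-≗ λ y → cong (_^ t) (avoiding-swap c₀ y z)

  grand-total : ∀ c₀ → ∑[ y < k ] row c₀ y ≡ total
  grand-total c₀ = begin
    ∑[ y < k ] row c₀ y          ≡⟨ ∑-constant-off₁ c₀ (row c₀) (λ y → row-other) ⟩
    row c₀ c₀ + u₁ * row≠         ≡⟨ cong (_+ u₁ * row≠) (row-self c₀) ⟩
    total                         ∎

  paired : ∀ c₀ c₁ c₃ → ∑[ c₂ < k ] (𝟙 (c₂ ≠ᵇ c₁) * ∑[ c₄ < k ] (𝟙 (c₄ ≠ᵇ c₃) * avoiding c₀ c₂ c₄ ^ t))
                         ≡ total - row c₀ c₃ - row c₀ c₁ + avoiding c₀ c₁ c₃ ^ t
  paired c₀ c₁ c₃ = trans (∑-except₂ c₁ c₃ (λ y z → avoiding c₀ y z ^ t))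
    (cong₂ (λ T C → T - C - row c₀ c₁ + avoiding c₀ c₁ c₃ ^ t) (grand-total c₀) (column c₀ c₃))

  term : Fin k → Fin k → Fin k → ℚ
  term c₀ c₁ c₃ = avoiding c₀ c₁ c₃ ^ s * (total - row c₀ c₃ - row c₀ c₁ + avoiding c₀ c₁ c₃ ^ t)

  term-value : ∀ {c₀ c₁ c₃ a r₃ r₁} → avoiding c₀ c₁ c₃ ≡ a → row c₀ c₃ ≡ r₃ → row c₀ c₁ ≡ r₁ →
               term c₀ c₁ c₃ ≡ a ^ s * (total - r₃ - r₁ + a ^ t)
  term-value refl refl refl = refl

  V₌ V≠ : ℚ
  V₌ = u₁ ^ s * (total - row₌ - row₌ + u₁ ^ t) + u₁ * (u₂ ^ s * (total - row≠ - row₌ + u₂ ^ t))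
  V≠ = u₂ ^ s * (total - row₌ - row≠ + u₂ ^ t) + u₂ ^ s * (total - row≠ - row≠ + u₂ ^ t)
       + u₂ * (u₃ ^ s * (total - row≠ - row≠ + u₃ ^ t))

  ∑term-self : ∀ c₀ → ∑[ c₃ < k ] term c₀ c₀ c₃ ≡ V₌
  ∑term-self c₀ = begin
    ∑[ c₃ < k ] term c₀ c₀ c₃
      ≡⟨ ∑-constant-off₁ c₀ _ (λ c₃ c₃≢c₀ → term-value (avoiding-aab (λ e → c₃≢c₀ (sym e))) (row-other c₃≢c₀) (row-self c₀)) ⟩
    term c₀ c₀ c₀ + u₁ * (u₂ ^ s * (total - row≠ - row₌ + u₂ ^ t))
      ≡⟨ cong (_+ u₁ * (u₂ ^ s * (total - row≠ - row₌ + u₂ ^ t))) (term-value (avoiding-one c₀) (row-self c₀) (row-self c₀)) ⟩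
    V₌ ∎

  ∑term-other : ∀ {c₀ c₁} → c₁ ≢ c₀ → ∑[ c₃ < k ] term c₀ c₁ c₃ ≡ V≠
  ∑term-other {c₀} {c₁} c₁≢c₀ = begin
    ∑[ c₃ < k ] term c₀ c₁ c₃
      ≡⟨ ∑-constant-off₂ c₀ c₁ _ c₀≢c₁ (λ c₃ c₃≢c₀ c₃≢c₁ →
           term-value (avoiding-three c₀≢c₁ (λ e → c₃≢c₀ (sym e)) (λ e → c₃≢c₁ (sym e))) (row-other c₃≢c₀) (row-other c₁≢c₀)) ⟩
    term c₀ c₁ c₀ + term c₀ c₁ c₁ + u₂ * (u₃ ^ s * (total - row≠ - row≠ + u₃ ^ t))
      ≡⟨ cong₂ (λ a b → a + b + u₂ * (u₃ ^ s * (total - row≠ - row≠ + u₃ ^ t)))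
           (term-value (avoiding-aba c₀≢c₁) (row-self c₀) (row-other c₁≢c₀))
           (term-value (avoiding-abb c₀≢c₁) (row-other c₁≢c₀) (row-other c₁≢c₀)) ⟩
    V≠ ∎
    where
    c₀≢c₁ : c₀ ≢ c₁
    c₀≢c₁ e = c₁≢c₀ (sym e)

  inner-sums : ∀ c₀ c₁ c₃ →
    ∑[ c₂ < k ] ∑[ c₄ < k ] (𝟙 (c₂ ≠ᵇ c₁ ∧ c₄ ≠ᵇ c₃) * (avoiding c₀ c₁ c₃ ^ s * avoiding c₀ c₂ c₄ ^ t)) ≡ term c₀ c₁ c₃
  inner-sums c₀ c₁ c₃ = begin
    ∑[ c₂ < k ] ∑[ c₄ < k ] (𝟙 (c₂ ≠ᵇ c₁ ∧ c₄ ≠ᵇ c₃) * (A * B c₂ c₄))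
      ≡⟨ sum-cong-≗ (λ c₂ → sum-cong-≗ λ c₄ → trans (cong (_* (A * B c₂ c₄)) (𝟙-∧ (c₂ ≠ᵇ c₁) (c₄ ≠ᵇ c₃)))
           (solve 4 (λ x y a b → (x :* y) :* (a :* b) := a :* (x :* (y :* b))) refl (𝟙 (c₂ ≠ᵇ c₁)) (𝟙 (c₄ ≠ᵇ c₃)) A (B c₂ c₄))) ⟩
    ∑[ c₂ < k ] ∑[ c₄ < k ] (A * (𝟙 (c₂ ≠ᵇ c₁) * (𝟙 (c₄ ≠ᵇ c₃) * B c₂ c₄)))
      ≡⟨ sum-cong-≗ (λ c₂ → sym (trans (cong (A *_) (*-distribˡ-sum (𝟙 (c₂ ≠ᵇ c₁)) (λ c₄ → 𝟙 (c₄ ≠ᵇ c₃) * B c₂ c₄)))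
                                         (*-distribˡ-sum A (λ c₄ → 𝟙 (c₂ ≠ᵇ c₁) * (𝟙 (c₄ ≠ᵇ c₃) * B c₂ c₄))))) ⟩
    ∑[ c₂ < k ] (A * (𝟙 (c₂ ≠ᵇ c₁) * ∑[ c₄ < k ] (𝟙 (c₄ ≠ᵇ c₃) * B c₂ c₄)))
      ≡⟨ *-distribˡ-sum A (λ c₂ → 𝟙 (c₂ ≠ᵇ c₁) * ∑[ c₄ < k ] (𝟙 (c₄ ≠ᵇ c₃) * B c₂ c₄)) ⟨
    A * ∑[ c₂ < k ] (𝟙 (c₂ ≠ᵇ c₁) * ∑[ c₄ < k ] (𝟙 (c₄ ≠ᵇ c₃) * B c₂ c₄))
      ≡⟨ cong (A *_) (paired c₀ c₁ c₃) ⟩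
    term c₀ c₁ c₃ ∎
    where
    A : ℚ
    A = avoiding c₀ c₁ c₃ ^ s
    B : Fin k → Fin k → ℚ
    B c₂ c₄ = avoiding c₀ c₂ c₄ ^ t

  colourings-closed-form : ℕtoℚ (numColourings (X s t) k) ≡ K * (V₌ + u₁ * V≠)
  colourings-closed-form = begin
    ℕtoℚ (numColourings (X s t) k)
      ≡⟨ colourings-of-X s t k ⟩
    ∑[ c₀ < k ] ∑[ c₁ < k ] ∑[ c₂ < k ] ∑[ c₃ < k ] ∑[ c₄ < k ] summand c₀ c₁ c₂ c₃ c₄
      ≡⟨ sum-cong-≗ (λ c₀ → sum-cong-≗ λ c₁ → ∑-comm (λ c₂ c₃ → ∑[ c₄ < k ] summand c₀ c₁ c₂ c₃ c₄)) ⟩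
    ∑[ c₀ < k ] ∑[ c₁ < k ] ∑[ c₃ < k ] ∑[ c₂ < k ] ∑[ c₄ < k ] summand c₀ c₁ c₂ c₃ c₄
      ≡⟨ sum-cong-≗ (λ c₀ → sum-cong-≗ λ c₁ → sum-cong-≗ λ c₃ → inner-sums c₀ c₁ c₃) ⟩
    ∑[ c₀ < k ] ∑[ c₁ < k ] ∑[ c₃ < k ] term c₀ c₁ c₃
      ≡⟨ sum-cong-≗ (λ c₀ → trans (∑-constant-off₁ c₀ (λ c₁ → ∑[ c₃ < k ] term c₀ c₁ c₃) (λ c₁ → ∑term-other))
                                  (cong (_+ u₁ * V≠) (∑term-self c₀))) ⟩
    ∑[ c₀ < k ] (V₌ + u₁ * V≠)
      ≡⟨ ∑-const k (V₌ + u₁ * V≠) ⟩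
    K * (V₌ + u₁ * V≠) ∎
    where
    summand : Fin k → Fin k → Fin k → Fin k → Fin k → ℚ
    summand c₀ c₁ c₂ c₃ c₄ = 𝟙 (c₂ ≠ᵇ c₁ ∧ c₄ ≠ᵇ c₃) * (avoiding c₀ c₁ c₃ ^ s * avoiding c₀ c₂ c₄ ^ t)

-- H(x) = P(X(s,t), x) / (x (x-1) (x-2)), written over an arbitrary semiring in terms of
-- uᵢ = x - i, Pᵢ = uᵢ^(s-1), Qᵢ = uᵢ^(t-1), so that one text serves as a polynomial
-- expression, as a rational function and as input to the ring solver.
H-shape : (R : RawSemiring 0ℓ 0ℓ) → (ℚ → RawSemiring.Carrier R) → (u₁ u₂ u₃ u₄ P₁ P₂ P₃ Q₁ Q₂ Q₃ : RawSemiring.Carrier R) → RawSemiring.Carrier R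
H-shape R ι u₁ u₂ u₃ u₄ P₁ P₂ P₃ Q₁ Q₂ Q₃ =
  P₁ *ᴿ u₁ *ᴿ Q₂ +ᴿ P₂ *ᴿ Q₁ *ᴿ u₁ +ᴿ ι (ℕtoℚ 2) *ᴿ P₂ *ᴿ u₂ *ᴿ Q₂ +ᴿ u₁ *ᴿ P₁ *ᴿ u₃ *ᴿ Q₃ +ᴿ ι (ℕtoℚ 7) *ᴿ u₂ *ᴿ P₂ *ᴿ u₂ *ᴿ Q₂
  +ᴿ ι (ℕtoℚ 2) *ᴿ u₂ *ᴿ P₂ *ᴿ u₃ *ᴿ Q₃ +ᴿ u₃ *ᴿ P₃ *ᴿ u₁ *ᴿ Q₁ +ᴿ ι (ℕtoℚ 2) *ᴿ u₃ *ᴿ P₃ *ᴿ u₂ *ᴿ Q₂ +ᴿ u₃ *ᴿ P₃ *ᴿ u₃ *ᴿ Q₃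
  +ᴿ ι (ℕtoℚ 3) *ᴿ u₃ *ᴿ u₂ *ᴿ P₂ *ᴿ u₃ *ᴿ Q₃ +ᴿ ι (ℕtoℚ 3) *ᴿ u₃ *ᴿ u₃ *ᴿ P₃ *ᴿ u₂ *ᴿ Q₂ +ᴿ ι (ℕtoℚ 2) *ᴿ u₃ *ᴿ u₃ *ᴿ P₃ *ᴿ u₃ *ᴿ Q₃
  +ᴿ u₃ *ᴿ u₄ *ᴿ u₃ *ᴿ P₃ *ᴿ u₃ *ᴿ Q₃
  where open RawSemiring R using () renaming (_+_ to infixl 6 _+ᴿ_; _*_ to infixl 7 _*ᴿ_)

expr-rawSemiring : RawSemiring 0ℓ 0ℓ
expr-rawSemiring = record { Carrier = PolyExpr ; _≈_ = _≡_ ; _+_ = _⊞_ ; _*_ = _⊠_ ; 0# = cst 0ℚ ; 1# = cst 1ℚ }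

solver-rawSemiring : ℕ → RawSemiring 0ℓ 0ℓ
solver-rawSemiring m = record { Carrier = Polynomial m ; _≈_ = _≡_ ; _+_ = _:+_ ; _*_ = _:*_ ; 0# = con 0ℚ ; 1# = con 1ℚ }

module ChromaticFactors (s′ t′ : ℕ) where

  shifted : ℕ → PolyExpr
  shifted i = var ⊟ cst (ℕtoℚ i)

  Hₑ : PolyExpr
  Hₑ = H-shape expr-rawSemiring cst (shifted 1) (shifted 2) (shifted 3) (shifted 4)
         (shifted 1 ⊡ s′) (shifted 2 ⊡ s′) (shifted 3 ⊡ s′) (shifted 1 ⊡ t′) (shifted 2 ⊡ t′) (shifted 3 ⊡ t′)

  H G : Poly
  H = toPoly Hₑ
  G = toPoly (var ⊠ shifted 1 ⊠ shifted 2)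

  colourings≡G*H : ∀ k → ℕtoℚ (numColourings (X (suc s′) (suc t′)) k) ≡ evalQ G (ℕtoℚ k) * evalQ H (ℕtoℚ k)
  colourings≡G*H k = begin
    ℕtoℚ (numColourings (X (suc s′) (suc t′)) k)     ≡⟨ colourings-closed-form ⟩
    K * (V₌ + u₁ * V≠)                                ≡⟨ factorisation ⟩
    ⟦ var ⊠ shifted 1 ⊠ shifted 2 ⟧ K * ⟦ Hₑ ⟧ K      ≡⟨ cong₂ _*_ (evalQ-toPoly (var ⊠ shifted 1 ⊠ shifted 2) K) (evalQ-toPoly Hₑ K) ⟨
    evalQ G K * evalQ H K                             ∎
    where
    open ClosedForm k (suc s′) (suc t′)
    factorisation : K * (V₌ + u₁ * V≠) ≡ ⟦ var ⊠ shifted 1 ⊠ shifted 2 ⟧ K * ⟦ Hₑ ⟧ K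
    factorisation = solve 7 (λ x P₁ P₂ P₃ Q₁ Q₂ Q₃ →
      let u₁ = x :- con 1ℚ ; u₂ = x :- con (ℕtoℚ 2) ; u₃ = x :- con (ℕtoℚ 3) ; u₄ = x :- con (ℕtoℚ 4)
          row₌ = u₁ :* Q₁ :+ u₁ :* (u₂ :* Q₂)
          row≠ = u₂ :* Q₂ :+ u₂ :* Q₂ :+ u₂ :* (u₃ :* Q₃)
          total = row₌ :+ u₁ :* row≠
          V₌ = u₁ :* P₁ :* (total :- row₌ :- row₌ :+ u₁ :* Q₁) :+ u₁ :* (u₂ :* P₂ :* (total :- row≠ :- row₌ :+ u₂ :* Q₂))
          V≠ = u₂ :* P₂ :* (total :- row₌ :- row≠ :+ u₂ :* Q₂) :+ u₂ :* P₂ :* (total :- row≠ :- row≠ :+ u₂ :* Q₂)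
               :+ u₂ :* (u₃ :* P₃ :* (total :- row≠ :- row≠ :+ u₃ :* Q₃))
      in x :* (V₌ :+ u₁ :* V≠) := x :* u₁ :* u₂ :* H-shape (solver-rawSemiring 7) con u₁ u₂ u₃ u₄ P₁ P₂ P₃ Q₁ Q₂ Q₃) refl
      K (u₁ ^ s′) (u₂ ^ s′) (u₃ ^ s′) (u₁ ^ t′) (u₂ ^ t′) (u₃ ^ t′)

Hℚ : ℚ → (P₁ P₂ P₃ Q₁ Q₂ Q₃ : ℚ) → ℚ
Hℚ x = H-shape +-*-rawSemiring (λ c → c) (x - 1ℚ) (x - ℕtoℚ 2) (x - ℕtoℚ 3) (x - ℕtoℚ 4)

Hℚ-cong : ∀ x {P₁ P₂ P₃ Q₁ Q₂ Q₃ P₁′ P₂′ P₃′ Q₁′ Q₂′ Q₃′} → P₁ ≡ P₁′ → P₂ ≡ P₂′ → P₃ ≡ P₃′ → Q₁ ≡ Q₁′ → Q₂ ≡ Q₂′ → Q₃ ≡ Q₃′ →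
          Hℚ x P₁ P₂ P₃ Q₁ Q₂ Q₃ ≡ Hℚ x P₁′ P₂′ P₃′ Q₁′ Q₂′ Q₃′
Hℚ-cong x refl refl refl refl refl refl = refl

1≤4^n : ∀ n → 1ℚ ≤ ℕtoℚ 4 ^ n
1≤4^n zero = ≤-refl
1≤4^n (suc n) = *-mono-≤-0≤ (0≤fraction 1 0) (0≤fraction 1 0) (fraction-≤ 1 0 4 0 (s≤s z≤n)) (1≤4^n n)

-- s = 2a + 3 and t = 2b + 3, so that the exponents s - 1 and t - 1 are even.
module OddOrders (a b : ℕ) where
  open ChromaticFactors (2 ℕ.* suc a) (2 ℕ.* suc b)

  evalQ-H : ∀ x → evalQ H x ≡ Hℚ x ((x - 1ℚ) ^ (2 ℕ.* suc a)) ((x - ℕtoℚ 2) ^ (2 ℕ.* suc a)) ((x - ℕtoℚ 3) ^ (2 ℕ.* suc a))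
                                    ((x - 1ℚ) ^ (2 ℕ.* suc b)) ((x - ℕtoℚ 2) ^ (2 ℕ.* suc b)) ((x - ℕtoℚ 3) ^ (2 ℕ.* suc b))
  evalQ-H x = evalQ-toPoly Hₑ x

  even-power-of-±1 : ∀ y m → y * y ≡ 1ℚ → y ^ (2 ℕ.* m) ≡ 1ℚ
  even-power-of-±1 y m y²≡1 = trans (^-double y m) (trans (cong (_^ m) y²≡1) (1^n≡1 m))

  H[2]≡-1 : evalQ H (ℕtoℚ 2) ≡ - 1ℚ
  H[2]≡-1 = trans (evalQ-H (ℕtoℚ 2))
    (Hℚ-cong (ℕtoℚ 2) (1^n≡1 (2 ℕ.* suc a)) (0^suc≡0 (a ℕ.+ 1 ℕ.* suc a)) (even-power-of-±1 (ℕtoℚ 2 - ℕtoℚ 3) (suc a) refl)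
                      (1^n≡1 (2 ℕ.* suc b)) (0^suc≡0 (b ℕ.+ 1 ℕ.* suc b)) (even-power-of-±1 (ℕtoℚ 2 - ℕtoℚ 3) (suc b) refl))

  -- At x = 1 we have u₁ = 0, u₂ = -1, u₃ = -2; with A = 4^a and B = 4^b the excess H(1) - 1 is
  -- 32A(B - 1) + 32B(A - 1) + 128AB + 4 ≥ 0.
  1≤H[1] : 1ℚ ≤ evalQ H 1ℚ
  1≤H[1] = subst (1ℚ ≤_) (sym H[1]) (≤-by-difference
    (ℕtoℚ 32 * A * (B - 1ℚ) + ℕtoℚ 32 * B * (A - 1ℚ) + ℕtoℚ 128 * A * B + ℕtoℚ 4)
    (+-mono-≤ (+-mono-≤ (+-mono-≤ (0≤* (0≤* (0≤fraction 32 0) 0≤A) (p≤q⇒0≤q-p (1≤4^n b)))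
                                  (0≤* (0≤* (0≤fraction 32 0) 0≤B) (p≤q⇒0≤q-p (1≤4^n a))))
                        (0≤* (0≤* (0≤fraction 128 0) 0≤A) 0≤B))
              (0≤fraction 4 0))
    (solve 2 (λ A B → H-shape (solver-rawSemiring 2) con (con (1ℚ - 1ℚ)) (con (1ℚ - ℕtoℚ 2)) (con (1ℚ - ℕtoℚ 3)) (con (1ℚ - ℕtoℚ 4))
                        (con 0ℚ) (con 1ℚ) (con (ℕtoℚ 4) :* A) (con 0ℚ) (con 1ℚ) (con (ℕtoℚ 4) :* B) :- con 1ℚ
                      := con (ℕtoℚ 32) :* A :* (B :- con 1ℚ) :+ con (ℕtoℚ 32) :* B :* (A :- con 1ℚ) :+ con (ℕtoℚ 128) :* A :* B :+ con (ℕtoℚ 4))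
           refl A B))
    where
    A B : ℚ
    A = ℕtoℚ 4 ^ a
    B = ℕtoℚ 4 ^ b
    0≤A : 0ℚ ≤ A
    0≤A = ≤-trans (0≤fraction 1 0) (1≤4^n a)
    0≤B : 0ℚ ≤ B
    0≤B = ≤-trans (0≤fraction 1 0) (1≤4^n b)
    H[1] : evalQ H 1ℚ ≡ Hℚ 1ℚ 0ℚ 1ℚ (ℕtoℚ 4 * A) 0ℚ 1ℚ (ℕtoℚ 4 * B)
    H[1] = trans (evalQ-H 1ℚ)
      (Hℚ-cong 1ℚ (0^suc≡0 (a ℕ.+ 1 ℕ.* suc a)) (even-power-of-±1 (1ℚ - ℕtoℚ 2) (suc a) refl) (^-double (1ℚ - ℕtoℚ 3) (suc a))
                  (0^suc≡0 (b ℕ.+ 1 ℕ.* suc b)) (even-power-of-±1 (1ℚ - ℕtoℚ 2) (suc b) refl) (^-double (1ℚ - ℕtoℚ 3) (suc b)))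

chromatic-root-between-1-and-2 : ∀ a b p → IsChromaticPolynomial (X (suc (2 ℕ.* suc a)) (suc (2 ℕ.* suc b))) p →
                                 HasRealRootIn (ℕtoℚ 1) (ℕtoℚ 2) p
chromatic-root-between-1-and-2 a b p p-chromatic =
  hasRealRootIn-factor G H p (0≤fraction 1 0) p≡G*H (sign-change⇒root H 1≤H[1] (≤-reflexive H[2]≡-1))
  where
  open ChromaticFactors (2 ℕ.* suc a) (2 ℕ.* suc b)
  open OddOrders a b
  p≡G*H : ∀ x → evalQ p x ≡ evalQ G x * evalQ H x
  p≡G*H x = trans (agree-on-ℕ⇒agree p (G ⊗ H) agree x) (evalQ-⊗ G H x)
    where
    agree : ∀ m → evalQ p (ℕtoℚ m) ≡ evalQ (G ⊗ H) (ℕtoℚ m)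
    agree m = begin
      evalQ p (ℕtoℚ m)                                              ≡⟨ p-chromatic m ⟩
      ℕtoℚ (numColourings (X (suc (2 ℕ.* suc a)) (suc (2 ℕ.* suc b))) m) ≡⟨ colourings≡G*H m ⟩
      evalQ G (ℕtoℚ m) * evalQ H (ℕtoℚ m)                           ≡⟨ evalQ-⊗ G H (ℕtoℚ m) ⟨
      evalQ (G ⊗ H) (ℕtoℚ m)                                        ∎

root-of-odd-X : ∀ s t → Odd s → Odd t → 3 ℕ.≤ s → 3 ℕ.≤ t → ∀ p → IsChromaticPolynomial (X s t) p →
                HasRealRootIn (ℕtoℚ 1) (ℕtoℚ 2) p
root-of-odd-X _ _ (zero , refl) _ (s≤s ()) _
root-of-odd-X _ _ (suc a , refl) (zero , refl) _ (s≤s ())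
root-of-odd-X _ _ (suc a , refl) (suc b , refl) _ _ = chromatic-root-between-1-and-2 a b

mainTheorem1 : ∀ (s t : ℕ) → 3 ℕ.≤ s → 3 ℕ.≤ t →
    KConnected 3 (X s t) × ¬ Bipartite (X s t) ×
    (Odd s → Odd t → ∀ (p : Poly) → IsChromaticPolynomial (X s t) p →
      HasRealRootIn (ℕtoℚ 1) (ℕtoℚ 2) p)
mainTheorem1 s t 3≤s 3≤t =
  X-3-connected s t 3≤s 3≤t ,
  X-not-bipartite s t (ℕP.≤-trans (s≤s z≤n) 3≤s) (ℕP.≤-trans (s≤s z≤n) 3≤t) ,
  λ odd-s odd-t → root-of-odd-X s t odd-s odd-t 3≤s 3≤t
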